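{- Let $k$ be a positive integer and let $S=(1,s_2^{k-1})$, i.e. the finite sequence of length $k$ whose first term is $1$ and whose remaining $k-1$ terms all equal $s_2$, where $s_2\ge 2$. Then a $k$-$\chi_S$-critical caterpillar exists if and only if $k\le s_2+2$.
   Context: For a non-decreasing sequence $S=(s_1,\ldots,s_m)$ of positive integers, an $S$-packing $k$-coloring ($k\le m$) of a graph $G$ is a map $c:V(G)\to\{1,\ldots,k\}$ such that whenever $u\neq v$ and $c(u)=c(v)=i$, the shortest-path distance satisfies $d_G(u,v)>s_i$. The $S$-packing chromatic number $\chi_S(G)$ is the least $k$ such that $G$ admits an $S$-packing $k$-coloring (undefined/infinite if none exists). A graph $G$ is $k$-$\chi_S$-critical if $\chi_S(G)=k$ and $\chi_S(G-u)<\chi_S(G)$ for every $u\in V(G)$. A caterpillar is a tree in which removing all leaves yields a path (the spine). -}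

module Defs where

open import Data.Nat using (ℕ; zero; suc; _+_; _≤_; _<_)
open import Data.Bool using (Bool; true; false; if_then_else_)
open import Data.Fin using (Fin; toℕ; punchIn)
open import Data.List using (List; []; _∷_; _++_; take; length; map; allFin)
open import Data.Nat.ListAction using (sum)
open import Data.List.Relation.Unary.Unique.Propositional using (Unique)
open import Data.List.Membership.Propositional using (_∈_)
open import Data.Vec using (Vec; []; _∷_; replicate; lookup)
open import Data.Product using (Σ; ∃; _×_; _,_)
open import Data.Sum using (_⊎_)
open import Data.Unit using (⊤)
open import Relation.Nullary using (¬_)
open import Relation.Binary.PropositionalEquality using (_≡_; _≢_)
open import Function.Bundles using (_⇔_)

record Graph (n : ℕ) : Set where
  field
    adj    : Fin n → Fin n → Bool
    sym    : ∀ i j → adj i j ≡ adj j i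
    irrefl : ∀ i → adj i i ≡ false
open Graph public

delete : ∀ {n} → Graph (suc n) → Fin (suc n) → Graph n
delete G u = record
  { adj    = λ i j → adj G (punchIn u i) (punchIn u j)
  ; sym    = λ i j → sym G (punchIn u i) (punchIn u j)
  ; irrefl = λ i → irrefl G (punchIn u i) }

data Walk {n} (G : Graph n) : Fin n → Fin n → ℕ → Set where
  here : ∀ {u} → Walk G u u zero
  step : ∀ {u w v l} → adj G u w ≡ true → Walk G w v l → Walk G u v (suc l)

-- d_G(u,v) > s  (distance is the length of a shortest walk; ∞ if none)
DistGt : ∀ {n} → Graph n → Fin n → Fin n → ℕ → Set
DistGt G u v s = ∀ l → l ≤ s → ¬ Walk G u v l

Connected : ∀ {n} → Graph n → Set
Connected G = ∀ u v → ∃ λ l → Walk G u v l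

Chain : ∀ {n} → Graph n → List (Fin n) → Set
Chain G []           = ⊤
Chain G (x ∷ [])     = ⊤
Chain G (x ∷ y ∷ xs) = adj G x y ≡ true × Chain G (y ∷ xs)

-- a cycle: ≥ 3 distinct vertices, consecutive adjacent, last adjacent to first
HasCycle : ∀ {n} → Graph n → Set
HasCycle G = ∃ λ vs → 3 ≤ length vs × Unique vs × Chain G (vs ++ take 1 vs)

IsTree : ∀ {n} → Graph n → Set
IsTree G = Connected G × ¬ HasCycle G

degree : ∀ {n} → Graph n → Fin n → ℕ
degree {n} G i = sum (map (λ j → if adj G i j then 1 else 0) (allFin n))

IsLeaf : ∀ {n} → Graph n → Fin n → Set
IsLeaf G v = degree G v ≡ 1

data Consec {A : Set} : List A → A → A → Set where
  now   : ∀ {x y xs} → Consec (x ∷ y ∷ xs) x y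
  later : ∀ {z xs x y} → Consec xs x y → Consec (z ∷ xs) x y

-- The graph obtained by deleting all leaves (induced subgraph on the
-- non-leaves) is a path: its vertices can be listed without repetition as
-- p, and two of them are adjacent iff they are consecutive in p.
IsCaterpillar : ∀ {n} → Graph n → Set
IsCaterpillar {n} G =
  IsTree G ×
  ∃ λ (p : List (Fin n)) →
      (∀ v → (v ∈ p) ⇔ (¬ IsLeaf G v)) ×
      Unique p ×
      (∀ u v → u ∈ p → v ∈ p → (adj G u v ≡ true) ⇔ (Consec p u v ⊎ Consec p v u))

-- S-packing j-coloring, S = (s_1,…,s_m) given as Vec ℕ m (color i+1 ↔ index i)
PackingColorable : ∀ {m n} → Vec ℕ m → Graph n → ℕ → Set
PackingColorable {m} {n} S G j =
  j ≤ m ×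
  ∃ λ (c : Fin n → Fin m) →
      (∀ v → toℕ (c v) < j) ×
      (∀ u v → u ≢ v → c u ≡ c v → DistGt G u v (lookup S (c u)))

ChiS : ∀ {m n} → Vec ℕ m → Graph n → ℕ → Set
ChiS S G k = PackingColorable S G k × (∀ j → j < k → ¬ PackingColorable S G j)

Critical : ∀ {m n} → Vec ℕ m → Graph (suc n) → ℕ → Set
Critical S G k = ChiS S G k × (∀ u → ∃ λ j → j < k × ChiS S (delete G u) j)

seqS : (k s₂ : ℕ) → Vec ℕ k
seqS zero    s₂ = []
seqS (suc k) s₂ = 1 ∷ replicate k s₂

-- Call the color of S with distance 1 "color 1"; every other color needs distance more than s.  Every
-- caterpillar is (s + 2)-colorable: its leaves are pairwise non-adjacent and take color 1, while along the
-- spine the distance is the difference of positions, so the spine can cycle through the other s + 1 colors.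
-- Hence χ_S ≤ s + 2, which rules out k-critical caterpillars for k > s + 2.  Conversely, for every
-- 1 ≤ k ≤ s + 2 an explicit caterpillar is k-critical: it contains k − 1 vertices avoiding color 1 that are
-- pairwise within distance s, so k colors are needed; after deleting a vertex, some spine vertex that has
-- lost its leaves can join color 1 (for a few end leaves an explicit coloring is given instead), so k − 1
-- colors suffice.
module Submission where

open import Defs
open import Data.Nat as ℕ using (ℕ; zero; suc; _+_; _*_; _∸_; _⊓_; _≤_; _<_; z≤n; s≤s)
import Data.Nat.Properties as ℕₚ
open import Data.Nat.DivMod using (_%_; _/_; m≡m%n+[m/n]*n; m%n<n)
open import Data.Nat.ListAction using (sum)
open import Data.Bool as Bool using (Bool; true; false; if_then_else_; _∨_)
import Data.Bool.Properties as Boolₚ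
open Boolₚ using (¬-not)
open import Data.Fin as Fin using (Fin; toℕ; fromℕ<; punchIn; _↑ˡ_; _↑ʳ_; splitAt)
import Data.Fin.Properties as Finₚ
open import Data.List using (List; []; _∷_; _++_; map; tabulate)
open import Data.List.Properties using (map-tabulate)
open import Data.List.Membership.Propositional using (_∈_)
open import Data.List.Membership.Propositional.Properties using (∈-tabulate⁺; ∈-tabulate⁻)
import Data.List.Relation.Unary.Any as Any
open import Data.List.Relation.Unary.All as All using (All; []; _∷_)
open import Data.List.Relation.Unary.AllPairs using ([]; _∷_)
open import Data.List.Relation.Unary.Unique.Propositional using (Unique)
open import Data.List.Relation.Unary.Unique.Propositional.Properties using (tabulate⁺)
open import Data.Vec using (Vec; lookup)
open import Data.Vec.Properties using (lookup-replicate)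
import Data.Vec.Functional as Vector
open import Data.Product using (Σ; ∃; ∃₂; _×_; _,_; proj₁; proj₂)
open import Data.Sum using (_⊎_; inj₁; inj₂; [_,_]′)
open import Data.Empty using (⊥; ⊥-elim)
open import Data.Unit using (⊤; tt)
open import Function using (_∘_; _$_)
open import Function.Bundles using (_⇔_; mk⇔; Equivalence)
open import Algebra.Properties.CommutativeSemigroup ℕₚ.+-commutativeSemigroup using (x∙yz≈y∙xz)
open import Relation.Binary.Definitions using (tri<; tri≈; tri>)
open import Relation.Nullary using (¬_; Dec; yes; no; _×-dec_)
open import Relation.Nullary.Decidable using (decidable-stable; ¬?)
open import Relation.Binary.PropositionalEquality as ≡ using (_≡_; _≢_; refl; trans; cong; cong₂; subst; subst₂; module ≡-Reasoning)

-- Walks, distances and packing colorings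

module _ {n} {G : Graph n} where

  snoc : ∀ {u v w l} → Walk G u v l → adj G v w ≡ true → Walk G u w (suc l)
  snoc here      e = step e here
  snoc (step a w) e = step a (snoc w e)

  reverse : ∀ {u v l} → Walk G u v l → Walk G v u l
  reverse here                   = here
  reverse (step {u} {w} a p) = snoc (reverse p) (trans (sym G w u) a)

  DistGt-sym : ∀ {u v s} → DistGt G u v s → DistGt G v u s
  DistGt-sym d l l≤s w = d l l≤s (reverse w)

  adjacent⇒≢ : ∀ {u v} → adj G u v ≡ true → u ≢ v
  adjacent⇒≢ {u} a refl with trans (≡.sym a) (irrefl G u)
  ... | ()

  nonadjacent⇒DistGt₁ : ∀ {u v} → u ≢ v → adj G u v ≡ false → DistGt G u v 1
  nonadjacent⇒DistGt₁ u≢v _ 0 z≤n here = u≢v refl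
  nonadjacent⇒DistGt₁ _ ¬a 1 (s≤s z≤n) (step a here) with trans (≡.sym a) ¬a
  ... | ()

  walk? : ∀ u v l → Dec (Walk G u v l)
  walk? u v zero with u Fin.≟ v
  ... | yes refl = yes here
  ... | no u≢v   = no λ { here → u≢v refl }
  walk? u v (suc l) with Finₚ.any? (λ w → (adj G u w Bool.≟ true) ×-dec walk? w v l)
  ... | yes (w , a , p) = yes (step a p)
  ... | no ∄w           = no λ { (step a p) → ∄w (_ , a , p) }

  DistGt? : ∀ u v s → Dec (DistGt G u v s)
  DistGt? u v zero with walk? u v 0
  ... | yes w = no λ d → d 0 z≤n w
  ... | no ¬w = yes λ { .zero z≤n w → ¬w w }
  DistGt? u v (suc s) with DistGt? u v s | walk? u v (suc s)
  ... | no ¬d  | _     = no λ d → ¬d (λ l le → d l (ℕₚ.m≤n⇒m≤1+n le))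
  ... | yes _  | yes w = no λ d → d _ ℕₚ.≤-refl w
  ... | yes d  | no ¬w = yes λ l le w →
    [ (λ lt → d l (ℕₚ.≤-pred lt) w) , (λ { refl → ¬w w }) ]′ (ℕₚ.m≤n⇒m<n∨m≡n le)

delete-walk : ∀ {n} (G : Graph (suc n)) u {x y l} → Walk (delete G u) x y l → Walk G (punchIn u x) (punchIn u y) l
delete-walk G u here       = here
delete-walk G u (step a p) = step a (delete-walk G u p)

delete-DistGt : ∀ {n} (G : Graph (suc n)) u {x y s} → DistGt G (punchIn u x) (punchIn u y) s → DistGt (delete G u) x y s
delete-DistGt G u d l le w = d l le (delete-walk G u w)

IsPackingColoring : ∀ {m n} → Vec ℕ m → Graph n → ℕ → (Fin n → Fin m) → Set
IsPackingColoring S G j c = (∀ v → toℕ (c v) < j) × (∀ u v → u ≢ v → c u ≡ c v → DistGt G u v (lookup S (c u)))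

restrict-coloring : ∀ {m n} (S : Vec ℕ m) (G : Graph (suc n)) u j (c : Fin (suc n) → Fin m) → j ≤ m →
  (∀ v → v ≢ u → toℕ (c v) < j) →
  (∀ x y → x ≢ u → y ≢ u → x ≢ y → c x ≡ c y → DistGt G x y (lookup S (c x))) →
  PackingColorable S (delete G u) j
restrict-coloring S G u j c j≤m bounded packed =
  j≤m , c ∘ punchIn u , (λ v → bounded _ (Finₚ.punchInᵢ≢i u v)) ,
  λ x y x≢y e → delete-DistGt G u (packed _ _ (Finₚ.punchInᵢ≢i u x) (Finₚ.punchInᵢ≢i u y)
                                              (x≢y ∘ Finₚ.punchIn-injective u x y) e)

∃-function? : ∀ {m} n (P : (Fin n → Fin m) → Set) → (∀ f g → (∀ i → f i ≡ g i) → P f → P g) →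
              (∀ f → Dec (P f)) → Dec (∃ P)
∃-function? zero P resp P? with P? (λ ())
... | yes p = yes (_ , p)
... | no ¬p = no λ { (f , pf) → ¬p (resp f _ (λ ()) pf) }
∃-function? (suc n) P resp P? with Finₚ.any? (λ a →
  ∃-function? n (λ g → P (a Vector.∷ g)) (λ f g eq → resp _ _ λ { Fin.zero → refl ; (Fin.suc i) → eq i }) (λ g → P? (a Vector.∷ g)))
... | yes (a , g , p) = yes (_ , p)
... | no ∄ = no λ { (f , pf) → ∄ (Vector.head f , Vector.tail f , resp f _ (λ { Fin.zero → refl ; (Fin.suc i) → refl }) pf) }

isPackingColoring? : ∀ {m n} (S : Vec ℕ m) (G : Graph n) j c → Dec (IsPackingColoring S G j c)
isPackingColoring? S G j c = Finₚ.all? (λ v → toℕ (c v) ℕ.<? j) ×-dec Finₚ.all? (λ u → Finₚ.all? (packed? u))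
  where
  packed? : ∀ u v → Dec (u ≢ v → c u ≡ c v → DistGt G u v (lookup S (c u)))
  packed? u v with u Fin.≟ v | c u Fin.≟ c v
  ... | yes u≡v | _        = yes λ u≢v → ⊥-elim (u≢v u≡v)
  ... | no _    | no cu≢cv = yes λ _ e → ⊥-elim (cu≢cv e)
  ... | no u≢v  | yes e with DistGt? u v (lookup S (c u))
  ...   | yes d = yes λ _ _ → d
  ...   | no ¬d = no λ h → ¬d (h u≢v e)

IsPackingColoring-resp : ∀ {m n} {S : Vec ℕ m} {G : Graph n} {j} f g → (∀ i → f i ≡ g i) →
                         IsPackingColoring S G j f → IsPackingColoring S G j g
IsPackingColoring-resp {S = S} {G} {j} f g f≗g (bounded , packed) =
  (λ v → subst (λ z → toℕ z < j) (f≗g v) (bounded v)) ,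
  λ u w u≢w e → subst (λ z → DistGt G u w (lookup S z)) (f≗g u) (packed u w u≢w (trans (f≗g u) (trans e (≡.sym (f≗g w)))))

packingColorable? : ∀ {m n} (S : Vec ℕ m) (G : Graph n) j → Dec (PackingColorable S G j)
packingColorable? {m} {n} S G j with j ℕ.≤? m | ∃-function? n (IsPackingColoring S G j) (IsPackingColoring-resp {S = S} {G}) (isPackingColoring? S G j)
... | no j≰m | _                   = no (j≰m ∘ proj₁)
... | yes j≤m | yes (c , coloring) = yes (j≤m , c , coloring)
... | yes _   | no ∄c              = no λ { (_ , c , coloring) → ∄c (c , coloring) }

bounded-search : (P : ℕ → Set) → (∀ j → Dec (P j)) → ∀ b → (∀ i → i < b → ¬ P i) ⊎ (∃ λ i → i < b × P i × (∀ i′ → i′ < i → ¬ P i′))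
bounded-search P P? zero = inj₁ λ _ ()
bounded-search P P? (suc b) with bounded-search P P? b
... | inj₂ (i , i<b , pi , least) = inj₂ (i , ℕₚ.m≤n⇒m≤1+n i<b , pi , least)
... | inj₁ none with P? b
...   | yes pb = inj₂ (b , ℕₚ.≤-refl , pb , none)
...   | no ¬pb = inj₁ λ i i<1+b → [ none i , (λ { refl → ¬pb }) ]′ (ℕₚ.m≤n⇒m<n∨m≡n (ℕₚ.≤-pred i<1+b))

least-witness : (P : ℕ → Set) → (∀ j → Dec (P j)) → ∀ {j} → P j → ∃ λ i → i ≤ j × P i × (∀ i′ → i′ < i → ¬ P i′)
least-witness P P? {j} p with bounded-search P P? (suc j)
... | inj₁ none = ⊥-elim (none j ℕₚ.≤-refl p)
... | inj₂ (i , i<1+j , pi , least) = i , ℕₚ.≤-pred i<1+j , pi , least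

colorable⇒chiS≤ : ∀ {m n} (S : Vec ℕ m) (G : Graph n) {j} → PackingColorable S G j → ∃ λ i → i ≤ j × ChiS S G i
colorable⇒chiS≤ S G = least-witness (PackingColorable S G) (packingColorable? S G)

colorable⇒chiS< : ∀ {m n} (S : Vec ℕ m) (G : Graph n) {j k} → PackingColorable S G j → j < k → ∃ λ i → i < k × ChiS S G i
colorable⇒chiS< S G p j<k with colorable⇒chiS≤ S G p
... | i , i≤j , χ = i , ℕₚ.≤-<-trans i≤j j<k , χ

lookup-seqS : ∀ {k s} (i : Fin (suc k)) → (toℕ i ≡ 0 × lookup (seqS (suc k) s) i ≡ 1) ⊎ (0 < toℕ i × lookup (seqS (suc k) s) i ≡ s)
lookup-seqS Fin.zero            = inj₁ (refl , refl)
lookup-seqS {s = s} (Fin.suc i) = inj₂ (s≤s z≤n , lookup-replicate i s)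

colorable-mono : ∀ {m n} {S : Vec ℕ m} {G : Graph n} {i j} → i ≤ j → j ≤ m → PackingColorable S G i → PackingColorable S G j
colorable-mono i≤j j≤m (_ , c , bounded , packed) = j≤m , c , (λ v → ℕₚ.<-≤-trans (bounded v) i≤j) , packed

Within : ∀ {n} → Graph n → Fin n → Fin n → ℕ → Set
Within G u v s = ∃ λ l → l ≤ s × Walk G u v l

Within-sym : ∀ {n} {G : Graph n} {u v s} → Within G u v s → Within G v u s
Within-sym (l , l≤s , w) = l , l≤s , reverse w

-- Color 1 of S = (1, s, …, s) is the index Fin.zero.
module SeqSPacking {k s n} {G : Graph n} {j} {c : Fin n → Fin (suc k)}
                   (coloring : IsPackingColoring (seqS (suc k) s) G j c) where

  color₁-neighbor : ∀ {u v} → adj G u v ≡ true → toℕ (c u) ≡ 0 → 0 < toℕ (c v)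
  color₁-neighbor {u} {v} uv cu≡0 = ℕₚ.n≢0⇒n>0 λ cv≡0 → same-color (Finₚ.toℕ-injective (trans cu≡0 (≡.sym cv≡0)))
    where
    same-color : c u ≢ c v
    same-color cu≡cv with lookup-seqS (c u)
    ... | inj₁ (_ , S≡1)   = subst (DistGt G u v) S≡1 (proj₂ coloring u v (adjacent⇒≢ {G = G} uv) cu≡cv) 1 ℕₚ.≤-refl (step uv here)
    ... | inj₂ (cu>0 , _) = ℕₚ.<⇒≢ cu>0 (≡.sym cu≡0)

  near⇒different-colors : ∀ {u v} → u ≢ v → 0 < toℕ (c u) → Within G u v s → c u ≢ c v
  near⇒different-colors {u} {v} u≢v cu>0 (l , l≤s , w) cu≡cv with lookup-seqS (c u)
  ... | inj₁ (cu≡0 , _) = ℕₚ.<⇒≢ cu>0 (≡.sym cu≡0)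
  ... | inj₂ (_ , S≡s)  = subst (DistGt G u v) S≡s (proj₂ coloring u v u≢v cu≡cv) l l≤s w

  near-clique⇒colors : ∀ q (f : Fin (suc q) → Fin n) → (∀ a → 0 < toℕ (c (f a))) → (∀ a b → a ≢ b → f a ≢ f b) →
                        (∀ a b → Within G (f a) (f b) s) → suc q < j
  near-clique⇒colors q f nonfirst distinct near =
    subst (_≤ j) (ℕₚ.+-comm (suc q) 1)
      (ℕₚ.m≤o∸n⇒m+n≤o (suc q) (ℕₚ.≤-trans (s≤s z≤n) (bounded (f Fin.zero))) (Finₚ.injective⇒≤ {f = shifted} injective))
    where
    bounded = proj₁ coloring
    shifted : Fin (suc q) → Fin (j ∸ 1)
    shifted a = fromℕ< (ℕₚ.∸-monoˡ-< (bounded (f a)) (nonfirst a))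
    injective : ∀ {a b} → shifted a ≡ shifted b → a ≡ b
    injective {a} {b} eq with a Fin.≟ b
    ... | yes a≡b = a≡b
    ... | no a≢b  = ⊥-elim (near⇒different-colors (distinct a b a≢b) (nonfirst a) (near a b)
                      (Finₚ.toℕ-injective (ℕₚ.∸-cancelʳ-≡ (nonfirst a) (nonfirst b)
                        (trans (≡.sym (Finₚ.toℕ-fromℕ< _)) (trans (cong toℕ eq) (Finₚ.toℕ-fromℕ< _))))))

-- Caterpillars need at most s + 2 colors

indicator : Bool → ℕ
indicator b = if b then 1 else 0

count : ∀ {n} → (Fin n → Bool) → ℕ
count f = sum (tabulate (indicator ∘ f))

degree≡count : ∀ {n} (G : Graph n) v → degree G v ≡ count (adj G v)
degree≡count G v = cong sum (map-tabulate (λ x → x) (indicator ∘ adj G v))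

count≥1 : ∀ {n} (f : Fin n → Bool) a → f a ≡ true → 1 ≤ count f
count≥1 f Fin.zero    fa rewrite fa = s≤s z≤n
count≥1 f (Fin.suc a) fa = ℕₚ.≤-trans (count≥1 (f ∘ Fin.suc) a fa) (ℕₚ.m≤n+m _ (indicator (f Fin.zero)))

count≥2 : ∀ {n} (f : Fin n → Bool) a b → a ≢ b → f a ≡ true → f b ≡ true → 2 ≤ count f
count≥2 f Fin.zero    Fin.zero    a≢b _  _  = ⊥-elim (a≢b refl)
count≥2 f Fin.zero    (Fin.suc b) _   fa fb rewrite fa = s≤s (count≥1 (f ∘ Fin.suc) b fb)
count≥2 f (Fin.suc a) Fin.zero    _   fa fb rewrite fb = s≤s (count≥1 (f ∘ Fin.suc) a fa)
count≥2 f (Fin.suc a) (Fin.suc b) a≢b fa fb =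
  ℕₚ.≤-trans (count≥2 (f ∘ Fin.suc) a b (a≢b ∘ cong Fin.suc) fa fb) (ℕₚ.m≤n+m _ (indicator (f Fin.zero)))

count≡1 : ∀ {n} (f : Fin n → Bool) a → f a ≡ true → (∀ b → b ≢ a → f b ≡ false) → count f ≡ 1
count≡1 f Fin.zero fa others rewrite fa = cong suc (none (f ∘ Fin.suc) (λ b → others (Fin.suc b) λ ()))
  where
  none : ∀ {n} (g : Fin n → Bool) → (∀ b → g b ≡ false) → count g ≡ 0
  none {zero}  g _ = refl
  none {suc n} g ¬g rewrite ¬g Fin.zero = none (g ∘ Fin.suc) (¬g ∘ Fin.suc)
count≡1 f (Fin.suc a) fa others rewrite others Fin.zero (λ ()) =
  count≡1 (f ∘ Fin.suc) a fa (λ b b≢a → others (Fin.suc b) (b≢a ∘ Finₚ.suc-injective))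

leaf-neighbor-unique : ∀ {n} (G : Graph n) {w a b} → IsLeaf G w → adj G w a ≡ true → adj G w b ≡ true → a ≡ b
leaf-neighbor-unique G {w} {a} {b} leaf wa wb with a Fin.≟ b
... | yes a≡b = a≡b
... | no a≢b with subst (2 ≤_) (trans (≡.sym (degree≡count G w)) leaf) (count≥2 (adj G w) a b a≢b wa wb)
...   | s≤s ()

unique-neighbor⇒leaf : ∀ {n} (G : Graph n) {w} a → adj G w a ≡ true → (∀ b → adj G w b ≡ true → b ≡ a) → IsLeaf G w
unique-neighbor⇒leaf G {w} a wa unique =
  trans (degree≡count G w) (count≡1 (adj G w) a wa λ b b≢a → ¬-not λ wb → b≢a (unique b wb))

∸≡multiple : ∀ n a b → a % suc n ≡ b % suc n → b ∸ a ≡ (b / suc n ∸ a / suc n) * suc n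
∸≡multiple n a b a≡b = begin
    b ∸ a
  ≡⟨ cong₂ _∸_ (m≡m%n+[m/n]*n b N) (m≡m%n+[m/n]*n a N) ⟩
    (b % N + (b / N) * N) ∸ (a % N + (a / N) * N)
  ≡⟨ cong (λ r → (r + (b / N) * N) ∸ (a % N + (a / N) * N)) (≡.sym a≡b) ⟩
    (a % N + (b / N) * N) ∸ (a % N + (a / N) * N)
  ≡⟨ ℕₚ.[m+n]∸[m+o]≡n∸o (a % N) _ _ ⟩
    (b / N) * N ∸ (a / N) * N
  ≡⟨ ≡.sym (ℕₚ.*-distribʳ-∸ N (b / N) (a / N)) ⟩
    (b / N ∸ a / N) * N ∎
  where
  N = suc n
  open ≡-Reasoning

equal-mod⇒far : ∀ n {a b} → a % suc n ≡ b % suc n → a < b → a + suc n ≤ b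
equal-mod⇒far n {a} {b} a≡b a<b with b / suc n ∸ a / suc n | ∸≡multiple n a b a≡b
... | zero  | b∸a≡0 = ⊥-elim (ℕₚ.m>n⇒m∸n≢0 a<b b∸a≡0)
... | suc q | b∸a≡  = begin
    a + suc n            ≤⟨ ℕₚ.+-monoʳ-≤ a (ℕₚ.≤-trans (ℕₚ.m≤m+n (suc n) (q * suc n)) (ℕₚ.≤-reflexive (≡.sym b∸a≡))) ⟩
    a + (b ∸ a)          ≡⟨ ℕₚ.m+[n∸m]≡n (ℕₚ.<⇒≤ a<b) ⟩
    b                    ∎
  where open ℕₚ.≤-Reasoning

_∈?_ : ∀ {n} (x : Fin n) (xs : List (Fin n)) → Dec (x ∈ xs)
x ∈? xs = Any.any? (x Fin.≟_) xs

position : ∀ {n} → Fin n → List (Fin n) → ℕ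
position x []       = 0
position x (y ∷ ys) with x Fin.≟ y
... | yes _ = 0
... | no _  = suc (position x ys)

position-head : ∀ {n} (x : Fin n) ys → position x (x ∷ ys) ≡ 0
position-head x ys with x Fin.≟ x
... | yes _ = refl
... | no x≢x = ⊥-elim (x≢x refl)

position-tail : ∀ {n} {x y : Fin n} ys → x ≢ y → position x (y ∷ ys) ≡ suc (position x ys)
position-tail {x = x} {y} ys x≢y with x Fin.≟ y
... | yes x≡y = ⊥-elim (x≢y x≡y)
... | no _    = refl

position-injective : ∀ {n} {p : List (Fin n)} {x y} → x ∈ p → y ∈ p → position x p ≡ position y p → x ≡ y
position-injective {p = z ∷ zs} {x} {y} x∈p y∈p eq with x Fin.≟ z | y Fin.≟ z
... | yes x≡z | yes y≡z = trans x≡z (≡.sym y≡z)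
... | yes _   | no _    = ⊥-elim (ℕₚ.0≢1+n eq)
... | no _    | yes _   = ⊥-elim (ℕₚ.0≢1+n (≡.sym eq))
... | no x≢z  | no y≢z  = position-injective (∈-tail x∈p x≢z) (∈-tail y∈p y≢z) (ℕₚ.suc-injective eq)
  where
  ∈-tail : ∀ {w} → w ∈ z ∷ zs → w ≢ z → w ∈ zs
  ∈-tail (Any.here w≡z) w≢z = ⊥-elim (w≢z w≡z)
  ∈-tail (Any.there w∈zs) _ = w∈zs

Consec⇒∈ : ∀ {n} {p : List (Fin n)} {x y} → Consec p x y → x ∈ p × y ∈ p
Consec⇒∈ now       = Any.here refl , Any.there (Any.here refl)
Consec⇒∈ (later c) = Any.there (proj₁ (Consec⇒∈ c)) , Any.there (proj₂ (Consec⇒∈ c))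

Consec⇒position : ∀ {n} {p : List (Fin n)} {x y} → Unique p → Consec p x y → position y p ≡ suc (position x p)
Consec⇒position {x = x} {y} ((x≢y ∷ _) ∷ _) (now {xs = xs}) = begin
  position y (x ∷ y ∷ xs)   ≡⟨ position-tail (y ∷ xs) (x≢y ∘ ≡.sym) ⟩
  suc (position y (y ∷ xs)) ≡⟨ cong suc (position-head y xs) ⟩
  1                         ≡⟨ cong suc (≡.sym (position-head x (y ∷ xs))) ⟩
  suc (position x (x ∷ y ∷ xs)) ∎
  where open ≡-Reasoning
Consec⇒position (z∉ ∷ unique) (later {z = z} {xs = xs} c) = begin
  position _ (z ∷ xs)       ≡⟨ position-tail xs (λ e → All.lookup z∉ y∈ (≡.sym e)) ⟩
  suc (position _ xs)       ≡⟨ cong suc (Consec⇒position unique c) ⟩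
  suc (suc (position _ xs)) ≡⟨ cong suc (≡.sym (position-tail xs (λ e → All.lookup z∉ x∈ (≡.sym e)))) ⟩
  suc (position _ (z ∷ xs)) ∎
  where
  open ≡-Reasoning
  x∈ = proj₁ (Consec⇒∈ c)
  y∈ = proj₂ (Consec⇒∈ c)

module CaterpillarSpine {n} (G : Graph n) (p : List (Fin n))
  (∈p⇔nonleaf : ∀ v → (v ∈ p) ⇔ (¬ IsLeaf G v)) (unique : Unique p)
  (adj⇔Consec : ∀ u v → u ∈ p → v ∈ p → (adj G u v ≡ true) ⇔ (Consec p u v ⊎ Consec p v u)) where

  ∉p⇒leaf : ∀ {v} → ¬ (v ∈ p) → IsLeaf G v
  ∉p⇒leaf {v} v∉p = decidable-stable (degree G v ℕ.≟ 1) (v∉p ∘ Equivalence.from (∈p⇔nonleaf v))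

  position-adjacent : ∀ {x w} → x ∈ p → w ∈ p → adj G x w ≡ true → position w p ≤ suc (position x p)
  position-adjacent {x} {w} x∈p w∈p a with Equivalence.to (adj⇔Consec x w x∈p w∈p) a
  ... | inj₁ c = ℕₚ.≤-reflexive (Consec⇒position unique c)
  ... | inj₂ c = ℕₚ.≤-trans (ℕₚ.n≤1+n _) (ℕₚ.≤-trans (ℕₚ.≤-reflexive (≡.sym (Consec⇒position unique c))) (ℕₚ.n≤1+n _))

  -- A walk may step off the spine only onto a leaf, and must come back to the same spine vertex.
  position-walk : ∀ {x v l} → x ∈ p → v ∈ p → Walk G x v l → position v p ≤ position x p + l
  position-walk-step : ∀ {x w v l} → x ∈ p → v ∈ p → adj G x w ≡ true → Walk G w v l → position v p ≤ position x p + suc l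
  position-walk x∈p v∈p here         = ℕₚ.m≤m+n _ 0
  position-walk x∈p v∈p (step a rest) = position-walk-step x∈p v∈p a rest
  position-walk-step x∈p v∈p a here = ℕₚ.≤-trans (position-adjacent x∈p v∈p a) (ℕₚ.≤-reflexive (ℕₚ.+-comm 1 _))
  position-walk-step {x} {w} x∈p v∈p a (step a′ rest) with w ∈? p
  ... | yes w∈p = ℕₚ.≤-trans (position-walk-step w∈p v∈p a′ rest)
                    (ℕₚ.≤-trans (ℕₚ.+-monoˡ-≤ _ (position-adjacent x∈p w∈p a)) (ℕₚ.≤-reflexive (≡.sym (ℕₚ.+-suc _ _))))
  ... | no w∉p with leaf-neighbor-unique G (∉p⇒leaf w∉p) a′ (trans (sym G w x) a)
  ...   | refl = ℕₚ.≤-trans (position-walk x∈p v∈p rest) (ℕₚ.+-monoʳ-≤ (position x p) (ℕₚ.≤-trans (ℕₚ.n≤1+n _) (ℕₚ.n≤1+n _)))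

adjacent-leaves⇒K₂ : ∀ {n} (G : Graph n) → Connected G → ∀ {u v} → IsLeaf G u → IsLeaf G v → adj G u v ≡ true →
                     ∀ x → x ≡ u ⊎ x ≡ v
adjacent-leaves⇒K₂ G connected {u} {v} u-leaf v-leaf uv x = stays (inj₁ refl) (proj₂ (connected u x))
  where
  stays : ∀ {z x l} → z ≡ u ⊎ z ≡ v → Walk G z x l → x ≡ u ⊎ x ≡ v
  stays z∈ here = z∈
  stays (inj₁ refl) (step a rest) = stays (inj₂ (leaf-neighbor-unique G u-leaf a uv)) rest
  stays (inj₂ refl) (step a rest) = stays (inj₁ (leaf-neighbor-unique G v-leaf a (trans (sym G v u) uv))) rest

K₂-colorable : ∀ {m n} (S : Vec ℕ (suc (suc m))) (G : Graph n) {u v} → (∀ x → x ≡ u ⊎ x ≡ v) → PackingColorable S G 2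
K₂-colorable S G {u} {v} only-u-v = s≤s (s≤s z≤n) , c ∘ (Fin._≟ u) , bounded ∘ (Fin._≟ u) ,
  λ x y x≢y e → ⊥-elim (injective (x Fin.≟ u) (y Fin.≟ u) x≢y e)
  where
  c : ∀ {x} → Dec (x ≡ u) → Fin _
  c (yes _) = Fin.zero
  c (no _)  = Fin.suc Fin.zero
  bounded : ∀ {x} (x≟u : Dec (x ≡ u)) → toℕ (c x≟u) < 2
  bounded (yes _) = s≤s z≤n
  bounded (no _)  = s≤s (s≤s z≤n)
  injective : ∀ {x y} (x≟u : Dec (x ≡ u)) (y≟u : Dec (y ≡ u)) → x ≢ y → c x≟u ≢ c y≟u
  injective (yes refl) (yes refl) x≢y _ = x≢y refl
  injective {x} {y} (no x≢u) (no y≢u) x≢y _ with only-u-v x | only-u-v y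
  ... | inj₁ x≡u  | _          = x≢u x≡u
  ... | _         | inj₁ y≡u   = y≢u y≡u
  ... | inj₂ refl | inj₂ refl  = x≢y refl

module SpineColoring {n} (G : Graph n) (p : List (Fin n))
  (∈p⇔nonleaf : ∀ v → (v ∈ p) ⇔ (¬ IsLeaf G v)) (unique : Unique p)
  (adj⇔Consec : ∀ u v → u ∈ p → v ∈ p → (adj G u v ≡ true) ⇔ (Consec p u v ⊎ Consec p v u))
  (leaves-nonadjacent : ∀ u v → ¬ u ∈ p → ¬ v ∈ p → adj G u v ≡ false)
  (k s : ℕ) (s+1≤k : suc s ≤ k) where

  open CaterpillarSpine G p ∈p⇔nonleaf unique adj⇔Consec

  residue : ℕ → Fin k
  residue a = fromℕ< (ℕₚ.≤-trans (m%n<n a (suc s)) s+1≤k)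

  color : ∀ {x} → Dec (x ∈ p) → Fin (suc k)
  color {x} (yes _) = Fin.suc (residue (position x p))
  color     (no _)  = Fin.zero

  bounded : ∀ {x} (x∈?p : Dec (x ∈ p)) → toℕ (color x∈?p) < suc (suc s)
  bounded {x} (yes _) = s≤s (subst (_< suc s) (≡.sym (Finₚ.toℕ-fromℕ< _)) (m%n<n (position x p) (suc s)))
  bounded     (no _)  = s≤s z≤n

  spine-packed : ∀ {x y} → x ∈ p → y ∈ p → x ≢ y → position x p % suc s ≡ position y p % suc s → DistGt G x y s
  spine-packed {x} {y} x∈p y∈p x≢y x≡y l l≤s w with ℕₚ.<-cmp (position x p) (position y p)
  ... | tri< lt _ _ = ℕₚ.<⇒≱ (ℕₚ.+-monoʳ-< (position x p) (s≤s l≤s))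
                               (ℕₚ.≤-trans (equal-mod⇒far s x≡y lt) (position-walk x∈p y∈p w))
  ... | tri≈ _ eq _ = x≢y (position-injective x∈p y∈p eq)
  ... | tri> _ _ gt = ℕₚ.<⇒≱ (ℕₚ.+-monoʳ-< (position y p) (s≤s l≤s))
                               (ℕₚ.≤-trans (equal-mod⇒far s (≡.sym x≡y) gt) (position-walk y∈p x∈p (reverse w)))

  packed : ∀ x y (x∈?p : Dec (x ∈ p)) (y∈?p : Dec (y ∈ p)) → x ≢ y → color x∈?p ≡ color y∈?p →
           DistGt G x y (lookup (seqS (suc k) s) (color x∈?p))
  packed x y (yes x∈p) (yes y∈p) x≢y e =
    subst (DistGt G x y) (≡.sym (lookup-replicate (residue (position x p)) s))
      (spine-packed x∈p y∈p x≢y (trans (≡.sym (Finₚ.toℕ-fromℕ< _)) (trans (cong toℕ (Finₚ.suc-injective e)) (Finₚ.toℕ-fromℕ< _))))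
  packed x y (no x∉p) (no y∉p) x≢y _ = nonadjacent⇒DistGt₁ x≢y (leaves-nonadjacent x y x∉p y∉p)

  colorable : PackingColorable (seqS (suc k) s) G (suc (suc s))
  colorable = s≤s s+1≤k , color ∘ (_∈? p) , bounded ∘ (_∈? p) ,
              λ x y → packed x y (x ∈? p) (y ∈? p)

caterpillar-colorable : ∀ {n} k s (G : Graph n) → IsCaterpillar G → suc (suc s) ≤ k →
                        PackingColorable (seqS k s) G (suc (suc s))
caterpillar-colorable zero          _ _ _ ()
caterpillar-colorable (suc zero)    _ _ _ (s≤s ())
caterpillar-colorable (suc (suc k)) s G ((connected , _) , p , ∈p⇔nonleaf , unique , adj⇔Consec) s+2≤k
  with Finₚ.any? (λ u → Finₚ.any? (λ v → ¬? (u ∈? p) ×-dec (¬? (v ∈? p) ×-dec (adj G u v Bool.≟ true))))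
... | yes (u , v , u∉p , v∉p , uv) =
  colorable-mono {S = seqS (suc (suc k)) s} (s≤s (s≤s z≤n)) s+2≤k
    (K₂-colorable (seqS (suc (suc k)) s) G (adjacent-leaves⇒K₂ G connected (∉p⇒leaf u∉p) (∉p⇒leaf v∉p) uv))
  where open CaterpillarSpine G p ∈p⇔nonleaf unique adj⇔Consec
... | no ∄uv = SpineColoring.colorable G p ∈p⇔nonleaf unique adj⇔Consec
                 (λ u v u∉p v∉p → ¬-not λ uv → ∄uv (u , v , u∉p , v∉p , uv)) (suc k) s (ℕₚ.≤-pred s+2≤k)

-- Explicit caterpillars

-- When every edge joins consecutive levels and every vertex has at most one neighbor one level below it, a
-- walk that never immediately backtracks keeps climbing once it has climbed.  Read a cycle as a closed walk
-- from v₀: if it starts by climbing, the level of v₀ would exceed itself; otherwise it must end by climbing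
-- into v₀, and then v₀ has two distinct lower neighbors.
module Levelled {n} (G : Graph n) (level : Fin n → ℕ)
  (edge-level : ∀ a b → adj G a b ≡ true → level b ≡ suc (level a) ⊎ level a ≡ suc (level b))
  (lower-unique : ∀ v a b → adj G v a ≡ true → adj G v b ≡ true → level v ≡ suc (level a) → level v ≡ suc (level b) → a ≡ b)
  where

  NonBacktracking : Fin n → Fin n → List (Fin n) → Set
  NonBacktracking x y []       = ⊤
  NonBacktracking x y (z ∷ zs) = x ≢ z × NonBacktracking y z zs

  last-edge : Fin n → Fin n → List (Fin n) → Fin n × Fin n
  last-edge x y []       = x , y
  last-edge x y (z ∷ zs) = last-edge y z zs

  Climbing : Fin n × Fin n → Set
  Climbing (a , b) = level b ≡ suc (level a)

  keeps-climbing : ∀ x y zs → Chain G (x ∷ y ∷ zs) → NonBacktracking x y zs → Climbing (x , y) →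
                   level x < level (proj₂ (last-edge x y zs)) × Climbing (last-edge x y zs)
  keeps-climbing x y []       _          _          up = ℕₚ.≤-reflexive (≡.sym up) , up
  keeps-climbing x y (z ∷ zs) (xy , chain) (x≢z , nb) up with edge-level y z (proj₁ chain)
  ... | inj₁ up′ = ℕₚ.<-trans (ℕₚ.≤-reflexive (≡.sym up)) (proj₁ rest) , proj₂ rest
    where rest = keeps-climbing y z zs chain nb up′
  ... | inj₂ down = ⊥-elim (x≢z (lower-unique y x z (trans (sym G y x) xy) (proj₁ chain) up down))

  ends-climbing : ∀ x y zs → Chain G (x ∷ y ∷ zs) → NonBacktracking x y zs → level x ≤ level (proj₂ (last-edge x y zs)) →
                  Climbing (last-edge x y zs)
  ends-climbing x y [] (xy , _) _ x≤y with edge-level x y xy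
  ... | inj₁ up   = up
  ... | inj₂ down = ⊥-elim (ℕₚ.<⇒≱ (ℕₚ.≤-reflexive (≡.sym down)) x≤y)
  ends-climbing x y (z ∷ zs) (xy , chain) (x≢z , nb) x≤last with edge-level x y xy
  ... | inj₁ up   = proj₂ (keeps-climbing x y (z ∷ zs) (xy , chain) (x≢z , nb) up)
  ... | inj₂ down = ends-climbing y z zs chain nb (ℕₚ.≤-trans (ℕₚ.n≤1+n _) (ℕₚ.≤-trans (ℕₚ.≤-reflexive (≡.sym down)) x≤last))

  last : Fin n → List (Fin n) → Fin n
  last y []       = y
  last y (z ∷ zs) = last z zs

  last-∈ : ∀ y zs → last y zs ∈ y ∷ zs
  last-∈ y []       = Any.here refl
  last-∈ y (z ∷ zs) = Any.there (last-∈ z zs)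

  last-edge-∷ʳ : ∀ x y zs e → last-edge x y (zs ++ e ∷ []) ≡ (last y zs , e)
  last-edge-∷ʳ x y []       e = refl
  last-edge-∷ʳ x y (z ∷ zs) e = last-edge-∷ʳ y z zs e

  last-adjacent : ∀ {e} y zs → Chain G (y ∷ zs ++ e ∷ []) → adj G e (last y zs) ≡ true
  last-adjacent {e} y []       (ye , _)    = trans (sym G e y) ye
  last-adjacent     y (z ∷ zs) (_ , chain) = last-adjacent z zs chain

  unique⇒NonBacktracking : ∀ x y zs e → Unique (x ∷ y ∷ zs) → All (_≢ e) (x ∷ y ∷ zs) → NonBacktracking x y (zs ++ e ∷ [])
  unique⇒NonBacktracking x y []       e _                      (x≢e ∷ _) = x≢e , tt
  unique⇒NonBacktracking x y (z ∷ zs) e ((_ ∷ x≢z ∷ _) ∷ uniq) (_ ∷ ≢e) = x≢z , unique⇒NonBacktracking y z zs e uniq ≢e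

  closed-walk-impossible : ∀ v₀ v₁ v₂ rest → Chain G (v₀ ∷ v₁ ∷ v₂ ∷ rest ++ v₀ ∷ []) →
    NonBacktracking v₀ v₁ (v₂ ∷ rest ++ v₀ ∷ []) → v₁ ≢ last v₂ rest → ⊥
  closed-walk-impossible v₀ v₁ v₂ rest chain nb v₁≢last with edge-level v₀ v₁ (proj₁ chain)
  ... | inj₁ up   = ℕₚ.<-irrefl (cong (level ∘ proj₂) (≡.sym last≡)) (proj₁ (keeps-climbing v₀ v₁ _ chain nb up))
    where last≡ = last-edge-∷ʳ v₁ v₂ rest v₀
  ... | inj₂ down = v₁≢last (lower-unique v₀ v₁ (last v₂ rest) (proj₁ chain) (last-adjacent v₂ rest (proj₂ (proj₂ chain))) down into-v₀)
    where
    last≡ = last-edge-∷ʳ v₁ v₂ rest v₀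
    into-v₀ : level v₀ ≡ suc (level (last v₂ rest))
    into-v₀ = subst Climbing last≡ (ends-climbing v₀ v₁ _ chain nb (ℕₚ.≤-reflexive (cong (level ∘ proj₂) (≡.sym last≡))))

  acyclic : ¬ HasCycle G
  acyclic ([]               , ()                , _)
  acyclic (_ ∷ []           , s≤s ()            , _)
  acyclic (_ ∷ _ ∷ []       , s≤s (s≤s ())      , _)
  acyclic (v₀ ∷ v₁ ∷ v₂ ∷ rest , _ , ((v₀∉ ∷ v₀∉′) ∷ (v₁∉ ∷ uniq₁) ∷ uniq₂) , chain) =
    closed-walk-impossible v₀ v₁ v₂ rest chain
      (All.head v₀∉′ , unique⇒NonBacktracking v₁ v₂ rest v₀ ((v₁∉ ∷ uniq₁) ∷ uniq₂) (All.map (_∘ ≡.sym) (v₀∉ ∷ v₀∉′)))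
      (All.lookup (v₁∉ ∷ uniq₁) (last-∈ v₂ rest))

≡ᵇ⇒≡′ : ∀ {m n} → (m ℕ.≡ᵇ n) ≡ true → m ≡ n
≡ᵇ⇒≡′ {m} {n} e = ℕₚ.≡ᵇ⇒≡ m n (Equivalence.from Boolₚ.T-≡ e)

≡⇒≡ᵇ′ : ∀ {m n} → m ≡ n → (m ℕ.≡ᵇ n) ≡ true
≡⇒≡ᵇ′ {m} {n} e = Equivalence.to Boolₚ.T-≡ (ℕₚ.≡⇒≡ᵇ m n e)

1+n≡ᵇn : ∀ n → (suc n ℕ.≡ᵇ n) ≡ false
1+n≡ᵇn n = ¬-not (ℕₚ.1+n≢n ∘ ≡ᵇ⇒≡′ {suc n} {n})

∨-true : ∀ {a b} → a ∨ b ≡ true → a ≡ true ⊎ b ≡ true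
∨-true {true}  _ = inj₁ refl
∨-true {false} e = inj₂ e

Consec-tabulate⁻ : ∀ {A : Set} {n} (f : Fin n → A) {x y} → Consec (tabulate f) x y → ∃₂ λ i j → x ≡ f i × y ≡ f j × toℕ j ≡ suc (toℕ i)
Consec-tabulate⁻ {n = suc zero} f (later ())
Consec-tabulate⁻ {n = suc (suc n)} f now = Fin.zero , Fin.suc Fin.zero , refl , refl , refl
Consec-tabulate⁻ {n = suc (suc n)} f (later c) with Consec-tabulate⁻ (λ k → f (Fin.suc k)) c
... | i , j , e1 , e2 , e3 = Fin.suc i , Fin.suc j , e1 , e2 , cong suc e3

Consec-tabulate⁺ : ∀ {A : Set} {n} (f : Fin n → A) (i j : Fin n) → toℕ j ≡ suc (toℕ i) → Consec (tabulate f) (f i) (f j)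
Consec-tabulate⁺ f Fin.zero Fin.zero ()
Consec-tabulate⁺ f Fin.zero (Fin.suc Fin.zero) e = now
Consec-tabulate⁺ f Fin.zero (Fin.suc (Fin.suc j)) ()
Consec-tabulate⁺ f (Fin.suc i) Fin.zero ()
Consec-tabulate⁺ f (Fin.suc i) (Fin.suc j) e = later (Consec-tabulate⁺ (λ k → f (Fin.suc k)) i j (ℕₚ.suc-injective e))

-- Spine vertices 0 … L' and M leaves, leaf j hanging from spine vertex min (j ∸ d) L'.
module Caterpillar (L' M d : ℕ) where
  L : ℕ
  L = suc L'
  V : Set
  V = Fin (L + M)

  anchor : Fin M → ℕ
  anchor j = (toℕ j ∸ d) ⊓ L'

  anchor<L : ∀ j → anchor j < L
  anchor<L j = s≤s (ℕₚ.m⊓n≤n (toℕ j ∸ d) L')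

  adjacency : Fin L ⊎ Fin M → Fin L ⊎ Fin M → Bool
  adjacency (inj₁ i) (inj₁ j) = (suc (toℕ i) ℕ.≡ᵇ toℕ j) ∨ (suc (toℕ j) ℕ.≡ᵇ toℕ i)
  adjacency (inj₁ i) (inj₂ j) = (anchor j ℕ.≡ᵇ toℕ i)
  adjacency (inj₂ j) (inj₁ i) = (anchor j ℕ.≡ᵇ toℕ i)
  adjacency (inj₂ _) (inj₂ _) = false

  adjacency-sym : ∀ a b → adjacency a b ≡ adjacency b a
  adjacency-sym (inj₁ i) (inj₁ j) = Boolₚ.∨-comm ((suc (toℕ i) ℕ.≡ᵇ toℕ j)) ((suc (toℕ j) ℕ.≡ᵇ toℕ i))
  adjacency-sym (inj₁ i) (inj₂ j) = refl
  adjacency-sym (inj₂ j) (inj₁ i) = refl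
  adjacency-sym (inj₂ _) (inj₂ _) = refl

  adjacency-irrefl : ∀ a → adjacency a a ≡ false
  adjacency-irrefl (inj₁ i) rewrite 1+n≡ᵇn (toℕ i) = refl
  adjacency-irrefl (inj₂ j) = refl

  G : Graph (suc (L' + M))
  G = record { adj = λ u v → adjacency (splitAt L u) (splitAt L v)
             ; sym = λ u v → adjacency-sym (splitAt L u) (splitAt L v)
             ; irrefl = λ u → adjacency-irrefl (splitAt L u) }

  spine : Fin L → V
  spine i = i ↑ˡ M
  leaf : Fin M → V
  leaf j = L ↑ʳ j

  splitAt-spine : ∀ i → splitAt L (spine i) ≡ inj₁ i
  splitAt-spine i = Finₚ.splitAt-↑ˡ L i M
  splitAt-leaf : ∀ j → splitAt L (leaf j) ≡ inj₂ j
  splitAt-leaf j = Finₚ.splitAt-↑ʳ L M j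

  data View : V → Set where
    spineᵛ : ∀ i → View (spine i)
    leafᵛ : ∀ j → View (leaf j)

  view : ∀ v → View v
  view v with splitAt L v in eq
  ... | inj₁ i = subst View (Finₚ.splitAt⁻¹-↑ˡ eq) (spineᵛ i)
  ... | inj₂ j = subst View (Finₚ.splitAt⁻¹-↑ʳ eq) (leafᵛ j)

  spine-injective : ∀ {i j} → spine i ≡ spine j → i ≡ j
  spine-injective {i} {j} e = Finₚ.↑ˡ-injective M i j e
  leaf-injective : ∀ {i j} → leaf i ≡ leaf j → i ≡ j
  leaf-injective {i} {j} e = Finₚ.↑ʳ-injective L i j e
  spine≢leaf : ∀ i j → spine i ≢ leaf j
  spine≢leaf i j e with trans (≡.sym (splitAt-spine i)) (trans (cong (splitAt L) e) (splitAt-leaf j))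
  ... | ()

  adj-spine-spine : ∀ i j → adj G (spine i) (spine j) ≡ ((suc (toℕ i) ℕ.≡ᵇ toℕ j) ∨ (suc (toℕ j) ℕ.≡ᵇ toℕ i))
  adj-spine-spine i j rewrite splitAt-spine i | splitAt-spine j = refl
  adj-spine-leaf : ∀ i j → adj G (spine i) (leaf j) ≡ (anchor j ℕ.≡ᵇ toℕ i)
  adj-spine-leaf i j rewrite splitAt-spine i | splitAt-leaf j = refl
  adj-leaf-spine : ∀ i j → adj G (leaf j) (spine i) ≡ (anchor j ℕ.≡ᵇ toℕ i)
  adj-leaf-spine i j rewrite splitAt-spine i | splitAt-leaf j = refl
  adj-leaf-leaf : ∀ i j → adj G (leaf i) (leaf j) ≡ false
  adj-leaf-leaf i j rewrite splitAt-leaf i | splitAt-leaf j = refl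

  data Edge (u v : V) : Set where
    climb : ∀ i j → u ≡ spine i → v ≡ spine j → toℕ j ≡ suc (toℕ i) → Edge u v
    descend : ∀ i j → u ≡ spine i → v ≡ spine j → toℕ i ≡ suc (toℕ j) → Edge u v
    hang : ∀ i j → u ≡ spine i → v ≡ leaf j → anchor j ≡ toℕ i → Edge u v
    unhang : ∀ i j → u ≡ leaf j → v ≡ spine i → anchor j ≡ toℕ i → Edge u v

  edge′ : ∀ {u v} → View u → View v → adj G u v ≡ true → Edge u v
  edge′ (spineᵛ i) (spineᵛ j) e with ∨-true (trans (≡.sym (adj-spine-spine i j)) e)
  ... | inj₁ a = climb i j refl refl (≡.sym (≡ᵇ⇒≡′ a))
  ... | inj₂ b = descend i j refl refl (≡.sym (≡ᵇ⇒≡′ b))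
  edge′ (spineᵛ i) (leafᵛ j) e = hang i j refl refl (≡ᵇ⇒≡′ (trans (≡.sym (adj-spine-leaf i j)) e))
  edge′ (leafᵛ j) (spineᵛ i) e = unhang i j refl refl (≡ᵇ⇒≡′ (trans (≡.sym (adj-leaf-spine i j)) e))
  edge′ (leafᵛ i) (leafᵛ j) e = ⊥-elim (ℕₚ.0≢1+n (cong indicator (trans (≡.sym (adj-leaf-leaf i j)) e)))

  edge : ∀ {u v} → adj G u v ≡ true → Edge u v
  edge {u} {v} = edge′ (view u) (view v)

  edge⇒adj : ∀ {u v} → Edge u v → adj G u v ≡ true
  edge⇒adj (climb i j refl refl e) = trans (adj-spine-spine i j) (cong (_∨ (suc (toℕ j) ℕ.≡ᵇ toℕ i)) (≡⇒≡ᵇ′ (≡.sym e)))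
  edge⇒adj (descend i j refl refl e) = trans (adj-spine-spine i j) (trans (cong ((suc (toℕ i) ℕ.≡ᵇ toℕ j) ∨_) (≡⇒≡ᵇ′ (≡.sym e))) (Boolₚ.∨-comm ((suc (toℕ i) ℕ.≡ᵇ toℕ j)) true))
  edge⇒adj (hang i j refl refl e) = trans (adj-spine-leaf i j) (≡⇒≡ᵇ′ e)
  edge⇒adj (unhang i j refl refl e) = trans (adj-leaf-spine i j) (≡⇒≡ᵇ′ e)

  -- Drawn on two rows, the caterpillar has distance |column u − column v| + row u + row v between distinct
  -- vertices; walk-length-bound and within are the two halves of this formula.
  columnₛ : Fin L ⊎ Fin M → ℕ
  columnₛ (inj₁ i) = toℕ i
  columnₛ (inj₂ j) = anchor j
  column : V → ℕ
  column v = columnₛ (splitAt L v)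
  rowₛ : Fin L ⊎ Fin M → ℕ
  rowₛ (inj₁ _) = 0
  rowₛ (inj₂ _) = 1
  row : V → ℕ
  row v = rowₛ (splitAt L v)

  column-spine : ∀ i → column (spine i) ≡ toℕ i
  column-spine i rewrite splitAt-spine i = refl
  column-leaf : ∀ j → column (leaf j) ≡ anchor j
  column-leaf j rewrite splitAt-leaf j = refl
  row-spine : ∀ i → row (spine i) ≡ 0
  row-spine i rewrite splitAt-spine i = refl
  row-leaf : ∀ j → row (leaf j) ≡ 1
  row-leaf j rewrite splitAt-leaf j = refl

  spineAt : (a : ℕ) → .(a < L) → V
  spineAt a lt = spine (fromℕ< lt)
  column-spineAt : ∀ a .(lt : a < L) → column (spineAt a lt) ≡ a
  column-spineAt a lt = trans (column-spine _) (Finₚ.toℕ-fromℕ< lt)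

  column-edge : ∀ {u v} → Edge u v → column v ≤ suc (column u)
  column-edge (climb i j refl refl e) rewrite column-spine i | column-spine j = ℕₚ.≤-reflexive e
  column-edge (descend i j refl refl e) rewrite column-spine i | column-spine j =
    ℕₚ.≤-trans (ℕₚ.n≤1+n _) (ℕₚ.≤-trans (ℕₚ.≤-reflexive (≡.sym e)) (ℕₚ.n≤1+n _))
  column-edge (hang i j refl refl e) rewrite column-spine i | column-leaf j = ℕₚ.≤-trans (ℕₚ.≤-reflexive e) (ℕₚ.n≤1+n _)
  column-edge (unhang i j refl refl e) rewrite column-spine i | column-leaf j = ℕₚ.≤-trans (ℕₚ.≤-reflexive (≡.sym e)) (ℕₚ.n≤1+n _)

  column-walk : ∀ {u v l} → Walk G u v l → column v ≤ column u + l
  column-walk here = ℕₚ.m≤m+n _ 0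
  column-walk {u} {v} (step {w = w} {l = l} a rest) = begin
    column v             ≤⟨ column-walk rest ⟩
    column w + l         ≤⟨ ℕₚ.+-monoˡ-≤ l (column-edge (edge {u} {w} a)) ⟩
    suc (column u) + l   ≡⟨ ≡.sym (ℕₚ.+-suc (column u) l) ⟩
    column u + suc l     ∎
    where open ℕₚ.≤-Reasoning

  leaf-walk : ∀ {j v l} → v ≢ leaf j → Walk G (leaf j) v l → ∃ λ l′ → l ≡ suc l′ × Walk G (spineAt (anchor j) (anchor<L j)) v l′
  leaf-walk v≢ here = ⊥-elim (v≢ refl)
  leaf-walk {j} _ (step {w = w} {l = l′} a rest) with edge {leaf j} {w} a
  ... | climb i _ e _ _   = ⊥-elim (spine≢leaf i j (≡.sym e))
  ... | descend i _ e _ _ = ⊥-elim (spine≢leaf i j (≡.sym e))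
  ... | hang i _ e _ _    = ⊥-elim (spine≢leaf i j (≡.sym e))
  ... | unhang i j′ e refl anchor≡ with leaf-injective e
  ...   | refl = l′ , refl , subst (λ z → Walk G z _ l′) (cong spine (Finₚ.toℕ-injective (≡.sym (trans (Finₚ.toℕ-fromℕ< _) anchor≡)))) rest

  ≤+-suc : ∀ a b c → a ≤ b + c → a + 1 ≤ b + suc c
  ≤+-suc a b c le = subst₂ _≤_ (ℕₚ.+-comm 1 a) (≡.sym (ℕₚ.+-suc b c)) (s≤s le)

  ≤+-suc² : ∀ a b c → a ≤ b + c → a + 2 ≤ b + suc (suc c)
  ≤+-suc² a b c le = subst₂ _≤_ (ℕₚ.+-comm 2 a) (≡.sym (trans (ℕₚ.+-suc b (suc c)) (cong suc (ℕₚ.+-suc b c)))) (s≤s (s≤s le))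

  walk-length-bound′ : ∀ {u v l} → View u → View v → u ≢ v → Walk G u v l → column v + (row u + row v) ≤ column u + l
  walk-length-bound′ (spineᵛ i) (spineᵛ j) _ w rewrite row-spine i | row-spine j | ℕₚ.+-identityʳ (column (spine j)) = column-walk w
  walk-length-bound′ (leafᵛ j) (spineᵛ i) u≢v w with leaf-walk (u≢v ∘ ≡.sym) w
  ... | l′ , refl , w′ rewrite row-spine i | row-leaf j | column-leaf j =
    ≤+-suc _ _ _ (subst (λ z → column (spine i) ≤ z + l′) (column-spineAt _ _) (column-walk w′))
  walk-length-bound′ (spineᵛ i) (leafᵛ j) u≢v w with leaf-walk u≢v (reverse w)
  ... | l′ , refl , w′ rewrite row-spine i | row-leaf j | column-leaf j =
    ≤+-suc _ _ _ (subst (λ z → z ≤ column (spine i) + l′) (column-spineAt _ _) (column-walk (reverse w′)))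
  walk-length-bound′ (leafᵛ j) (leafᵛ j′) u≢v w with leaf-walk (u≢v ∘ ≡.sym) w
  ... | l′ , refl , w′ with leaf-walk (spine≢leaf _ j′) (reverse w′)
  ...   | l″ , refl , w″ rewrite row-leaf j | row-leaf j′ | column-leaf j | column-leaf j′ =
    ≤+-suc² _ _ _ (subst₂ (λ y z → y ≤ z + l″) (column-spineAt _ _) (column-spineAt _ _) (column-walk (reverse w″)))

  walk-length-bound : ∀ {u v l} → u ≢ v → Walk G u v l → column v + (row u + row v) ≤ column u + l
  walk-length-bound {u} {v} = walk-length-bound′ (view u) (view v)

  spine-walk : ∀ t (i j : Fin L) → toℕ j ≡ toℕ i + t → Walk G (spine i) (spine j) t
  spine-walk zero i j e = subst (λ z → Walk G (spine i) (spine z) 0) (Finₚ.toℕ-injective (trans (≡.sym (ℕₚ.+-identityʳ (toℕ i))) (≡.sym e))) here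
  spine-walk (suc t) i Fin.zero e = ⊥-elim (ℕₚ.0≢1+n (trans e (ℕₚ.+-suc (toℕ i) t)))
  spine-walk (suc t) i (Fin.suc j) e =
    snoc (spine-walk t i (Fin.inject₁ j) (trans (Finₚ.toℕ-inject₁ j) (ℕₚ.suc-injective (trans e (ℕₚ.+-suc (toℕ i) t)))))
         (edge⇒adj (climb (Fin.inject₁ j) (Fin.suc j) refl refl (cong suc (≡.sym (Finₚ.toℕ-inject₁ j)))))

  Within-spine : ∀ i j s → toℕ j ≤ toℕ i + s → toℕ i ≤ toℕ j + s → Within G (spine i) (spine j) s
  Within-spine i j s j≤ i≤ with ℕₚ.≤-total (toℕ i) (toℕ j)
  ... | inj₁ i≤j = _ , ℕₚ.m≤n+o⇒m∸n≤o (toℕ j) (toℕ i) j≤ , spine-walk (toℕ j ∸ toℕ i) i j (≡.sym (ℕₚ.m+[n∸m]≡n i≤j))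
  ... | inj₂ j≤i = _ , ℕₚ.m≤n+o⇒m∸n≤o (toℕ i) (toℕ j) i≤ , reverse (spine-walk (toℕ i ∸ toℕ j) j i (≡.sym (ℕₚ.m+[n∸m]≡n j≤i)))

  leaf-anchor-adj : ∀ j → adj G (leaf j) (spineAt (anchor j) (anchor<L j)) ≡ true
  leaf-anchor-adj j = edge⇒adj (unhang (fromℕ< (anchor<L j)) j refl refl (≡.sym (Finₚ.toℕ-fromℕ< (anchor<L j))))

  Within-via-anchor : ∀ j {v s} → Within G (spineAt (anchor j) (anchor<L j)) v s → Within G (leaf j) v (suc s)
  Within-via-anchor j (l , l≤s , w) = suc l , s≤s l≤s , step (leaf-anchor-adj j) w

  +-cancel-≤ : ∀ k a b c → a + k ≤ b + (k + c) → a ≤ b + c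
  +-cancel-≤ k a b c le = ℕₚ.+-cancelʳ-≤ k a (b + c) (subst (a + k ≤_) (trans (cong (b +_) (ℕₚ.+-comm k c)) (≡.sym (ℕₚ.+-assoc b c k))) le)

  +1-asym : ∀ a b → a + 1 ≤ b + 0 → b + 1 ≤ a + 0 → ⊥
  +1-asym a b h h′ = ℕₚ.<-asym (subst₂ _≤_ (ℕₚ.+-comm a 1) (ℕₚ.+-identityʳ b) h) (subst₂ _≤_ (ℕₚ.+-comm b 1) (ℕₚ.+-identityʳ a) h′)

  +2-asym : ∀ a b → a + 2 ≤ b + 1 → b + 2 ≤ a + 1 → ⊥
  +2-asym a b h h′ = +1-asym a b (+-cancel-≤ 1 (a + 1) b 0 (subst₂ _≤_ (≡.sym (ℕₚ.+-assoc a 1 1)) refl h))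
                                 (+-cancel-≤ 1 (b + 1) a 0 (subst₂ _≤_ (≡.sym (ℕₚ.+-assoc b 1 1)) refl h′))

  Close : V → V → ℕ → Set
  Close u v s = column u + (row u + row v) ≤ column v + s × column v + (row u + row v) ≤ column u + s

  Close-sym : ∀ {u v s} → Close u v s → Close v u s
  Close-sym {u} {v} {s} (h , h′) = subst (λ z → column v + z ≤ column u + s) (ℕₚ.+-comm (row u) (row v)) h′ ,
                                   subst (λ z → column u + z ≤ column v + s) (ℕₚ.+-comm (row u) (row v)) h

  Within-leaf-spine : ∀ j i s → Close (leaf j) (spine i) s → Within G (leaf j) (spine i) s
  Within-leaf-spine j i zero (h , h′) rewrite column-spine i | column-leaf j | row-spine i | row-leaf j = ⊥-elim (+1-asym _ _ h h′)
  Within-leaf-spine j i (suc s) (h , h′) rewrite column-spine i | column-leaf j | row-spine i | row-leaf j =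
    Within-via-anchor j (Within-spine (fromℕ< (anchor<L j)) i s
      (subst (λ z → toℕ i ≤ z + s) (≡.sym (Finₚ.toℕ-fromℕ< _)) (+-cancel-≤ 1 _ _ s h′))
      (subst (λ z → z ≤ toℕ i + s) (≡.sym (Finₚ.toℕ-fromℕ< _)) (+-cancel-≤ 1 _ _ s h)))

  Within-leaf-leaf : ∀ j j′ s → Close (leaf j) (leaf j′) s → Within G (leaf j) (leaf j′) s
  Within-leaf-leaf j j′ zero (h , h′) rewrite column-leaf j | column-leaf j′ | row-leaf j | row-leaf j′ =
    ⊥-elim (+1-asym _ _ (ℕₚ.≤-trans (ℕₚ.+-monoʳ-≤ (anchor j) (ℕₚ.n≤1+n 1)) h) (ℕₚ.≤-trans (ℕₚ.+-monoʳ-≤ (anchor j′) (ℕₚ.n≤1+n 1)) h′))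
  Within-leaf-leaf j j′ (suc zero) (h , h′) rewrite column-leaf j | column-leaf j′ | row-leaf j | row-leaf j′ = ⊥-elim (+2-asym _ _ h h′)
  Within-leaf-leaf j j′ (suc (suc s)) (h , h′) rewrite column-leaf j | column-leaf j′ | row-leaf j | row-leaf j′ =
    Within-via-anchor j (Within-sym (Within-via-anchor j′ (Within-sym (Within-spine (fromℕ< (anchor<L j)) (fromℕ< (anchor<L j′)) s
      (subst₂ (λ y z → y ≤ z + s) (≡.sym (Finₚ.toℕ-fromℕ< _)) (≡.sym (Finₚ.toℕ-fromℕ< _)) (+-cancel-≤ 2 _ _ s h′))
      (subst₂ (λ y z → y ≤ z + s) (≡.sym (Finₚ.toℕ-fromℕ< _)) (≡.sym (Finₚ.toℕ-fromℕ< _)) (+-cancel-≤ 2 _ _ s h))))))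

  within′ : ∀ {u v} → View u → View v → ∀ s → Close u v s → Within G u v s
  within′ (spineᵛ i) (spineᵛ j) s (h , h′) rewrite column-spine i | column-spine j | row-spine i | row-spine j
                                                  | ℕₚ.+-identityʳ (toℕ i) | ℕₚ.+-identityʳ (toℕ j) = Within-spine i j s h′ h
  within′ (leafᵛ j)  (spineᵛ i) s close = Within-leaf-spine j i s close
  within′ (spineᵛ i) (leafᵛ j)  s close = Within-sym (Within-leaf-spine j i s (Close-sym {spine i} {leaf j} close))
  within′ (leafᵛ j)  (leafᵛ j′) s close = Within-leaf-leaf j j′ s close

  within : ∀ u v s → Close u v s → Within G u v s
  within u v = within′ (view u) (view v)

  level : V → ℕ
  level v = column v + row v

  level-spine : ∀ i → level (spine i) ≡ toℕ i
  level-spine i rewrite column-spine i | row-spine i = ℕₚ.+-identityʳ _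

  level-leaf : ∀ j → level (leaf j) ≡ suc (anchor j)
  level-leaf j rewrite column-leaf j | row-leaf j = ℕₚ.+-comm _ 1

  edge-level : ∀ a b → adj G a b ≡ true → level b ≡ suc (level a) ⊎ level a ≡ suc (level b)
  edge-level a b e with edge {a} {b} e
  ... | climb i j refl refl x   = inj₁ (trans (level-spine j) (trans x (cong suc (≡.sym (level-spine i)))))
  ... | descend i j refl refl x = inj₂ (trans (level-spine i) (trans x (cong suc (≡.sym (level-spine j)))))
  ... | hang i j refl refl x    = inj₁ (trans (level-leaf j) (cong suc (trans x (≡.sym (level-spine i)))))
  ... | unhang i j refl refl x  = inj₂ (trans (level-leaf j) (cong suc (trans x (≡.sym (level-spine i)))))

  n≢2+n : ∀ {n} → n ≢ suc (suc n)
  n≢2+n = ℕₚ.<⇒≢ (ℕₚ.≤-trans (ℕₚ.n<1+n _) (ℕₚ.n≤1+n _))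

  data Below (v a : V) : Set where
    spine-below : ∀ i i′ → v ≡ spine i → a ≡ spine i′ → toℕ i ≡ suc (toℕ i′) → Below v a
    anchor-below : ∀ j i′ → v ≡ leaf j → a ≡ spine i′ → anchor j ≡ toℕ i′ → Below v a

  below : ∀ v a → adj G v a ≡ true → level v ≡ suc (level a) → Below v a
  below v a e h with edge {v} {a} e
  ... | climb i j refl refl x   = ⊥-elim (n≢2+n (trans (≡.sym (level-spine i)) (trans h (cong suc (trans (level-spine j) x)))))
  ... | descend i j refl refl x = spine-below i j refl refl x
  ... | hang i j refl refl x    = ⊥-elim (n≢2+n (trans (≡.sym (level-spine i)) (trans h (cong suc (trans (level-leaf j) (cong suc x))))))
  ... | unhang i j refl refl x  = anchor-below j i refl refl x

  below-unique : ∀ v a b → adj G v a ≡ true → adj G v b ≡ true → level v ≡ suc (level a) → level v ≡ suc (level b) → a ≡ b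
  below-unique v a b va vb a-below b-below with below v a va a-below | below v b vb b-below
  ... | spine-below i ia refl refl x | spine-below i′ ib e refl y with spine-injective e
  ...   | refl = cong spine (Finₚ.toℕ-injective (ℕₚ.suc-injective (trans (≡.sym x) y)))
  below-unique v a b _ _ _ _ | spine-below i _ refl _ _  | anchor-below j _ e _ _ = ⊥-elim (spine≢leaf i j e)
  below-unique v a b _ _ _ _ | anchor-below j _ refl _ _ | spine-below i _ e _ _  = ⊥-elim (spine≢leaf i j (≡.sym e))
  below-unique v a b _ _ _ _ | anchor-below j ia refl refl x | anchor-below j′ ib e refl y with leaf-injective e
  ...   | refl = cong spine (Finₚ.toℕ-injective (trans (≡.sym x) y))

  acyclic : ¬ HasCycle G
  acyclic = Levelled.acyclic G level edge-level below-unique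

  connected : Connected G
  connected u v with within u v (column u + column v + (row u + row v)) (far-enough (column u) (column v) (row u + row v) , far-enough′)
    where
    far-enough : ∀ a b w → a + w ≤ b + (a + b + w)
    far-enough a b w = ℕₚ.≤-trans (ℕₚ.+-monoˡ-≤ w (ℕₚ.m≤m+n a b)) (ℕₚ.m≤n+m _ b)
    far-enough′ : column v + (row u + row v) ≤ column u + (column u + column v + (row u + row v))
    far-enough′ = ℕₚ.≤-trans (ℕₚ.+-monoˡ-≤ _ (ℕₚ.m≤n+m (column v) (column u))) (ℕₚ.m≤n+m _ (column u))
  ... | l , _ , w = l , w

  spineList : List V
  spineList = tabulate spine

  leaf-isLeaf : ∀ j → IsLeaf G (leaf j)
  leaf-isLeaf j = unique-neighbor⇒leaf G {leaf j} (spineAt (anchor j) (anchor<L j)) (leaf-anchor-adj j) nb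
    where
    nb : ∀ b → adj G (leaf j) b ≡ true → b ≡ spineAt (anchor j) (anchor<L j)
    nb b e with edge {leaf j} {b} e
    ... | climb i _ e1 _ _ = ⊥-elim (spine≢leaf i j (≡.sym e1))
    ... | descend i _ e1 _ _ = ⊥-elim (spine≢leaf i j (≡.sym e1))
    ... | hang i _ e1 _ _ = ⊥-elim (spine≢leaf i j (≡.sym e1))
    ... | unhang i j' e1 refl x with leaf-injective e1
    ... | refl = cong spine (Finₚ.toℕ-injective (trans (≡.sym x) (≡.sym (Finₚ.toℕ-fromℕ< _))))

  module SpineOfNonLeaves (1≤L' : 1 ≤ L') (j₀ : Fin M) (j₀-anchor : anchor j₀ ≡ 0)
                          (jₑ : Fin M) (jₑ-anchor : anchor jₑ ≡ L') where

    LowerNeighbor : Fin L → V → Set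
    LowerNeighbor i a = (row a ≡ 0 × suc (column a) ≡ toℕ i) ⊎ (row a ≡ 1 × toℕ i ≡ 0)

    UpperNeighbor : Fin L → V → Set
    UpperNeighbor i b = (row b ≡ 0 × column b ≡ suc (toℕ i)) ⊎ (row b ≡ 1 × toℕ i ≡ L')

    lower-neighbor : ∀ i → ∃ λ a → adj G (spine i) a ≡ true × LowerNeighbor i a
    lower-neighbor Fin.zero    = leaf j₀ , edge⇒adj (hang Fin.zero j₀ refl refl j₀-anchor) , inj₂ (row-leaf j₀ , refl)
    lower-neighbor (Fin.suc i) =
      spine (Fin.inject₁ i) ,
      edge⇒adj (descend (Fin.suc i) (Fin.inject₁ i) refl refl (cong suc (≡.sym (Finₚ.toℕ-inject₁ i)))) ,
      inj₁ (row-spine (Fin.inject₁ i) , cong suc (trans (column-spine (Fin.inject₁ i)) (Finₚ.toℕ-inject₁ i)))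

    upper-neighbor : ∀ i → ∃ λ b → adj G (spine i) b ≡ true × UpperNeighbor i b
    upper-neighbor i with toℕ i ℕ.≟ L'
    ... | yes i≡L' = leaf jₑ , edge⇒adj (hang i jₑ refl refl (trans jₑ-anchor (≡.sym i≡L'))) , inj₂ (row-leaf jₑ , i≡L')
    ... | no i≢L'  = spine next , edge⇒adj (climb i next refl refl toℕ-next) , inj₁ (row-spine next , trans (column-spine next) toℕ-next)
      where
      next = fromℕ< (s≤s (ℕₚ.≤∧≢⇒< (ℕₚ.≤-pred (Finₚ.toℕ<n i)) i≢L'))
      toℕ-next = Finₚ.toℕ-fromℕ< (s≤s (ℕₚ.≤∧≢⇒< (ℕₚ.≤-pred (Finₚ.toℕ<n i)) i≢L'))

    lower≢upper : ∀ {i a b} → LowerNeighbor i a → UpperNeighbor i b → a ≢ b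
    lower≢upper (inj₁ (_ , a<i))  (inj₁ (_ , b>i))  refl = n≢2+n (trans (≡.sym a<i) (cong suc b>i))
    lower≢upper (inj₁ (row₀ , _)) (inj₂ (row₁ , _)) refl = ℕₚ.0≢1+n (trans (≡.sym row₀) row₁)
    lower≢upper (inj₂ (row₁ , _)) (inj₁ (row₀ , _)) refl = ℕₚ.0≢1+n (trans (≡.sym row₀) row₁)
    lower≢upper (inj₂ (_ , i≡0))  (inj₂ (_ , i≡L')) refl = ℕₚ.<⇒≢ 1≤L' (trans (≡.sym i≡0) i≡L')

    spine-nonleaf : ∀ i → ¬ IsLeaf G (spine i)
    spine-nonleaf i leaf-i with lower-neighbor i | upper-neighbor i
    ... | a , ia , lower | b , ib , upper
      with subst (2 ≤_) (trans (≡.sym (degree≡count G (spine i))) leaf-i)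
                 (count≥2 (adj G (spine i)) a b (lower≢upper lower upper) ia ib)
    ...   | s≤s ()

    ∈spine⇔nonleaf : ∀ v → (v ∈ spineList) ⇔ (¬ IsLeaf G v)
    ∈spine⇔nonleaf v = mk⇔ to (from (view v))
      where
      to : v ∈ spineList → ¬ IsLeaf G v
      to v∈ with ∈-tabulate⁻ {f = spine} v∈
      ... | i , refl = spine-nonleaf i
      from : ∀ {v} → View v → ¬ IsLeaf G v → v ∈ spineList
      from (spineᵛ i) _       = ∈-tabulate⁺ {f = spine} i
      from (leafᵛ j)  nonleaf = ⊥-elim (nonleaf (leaf-isLeaf j))

    adj⇔Consec : ∀ u v → u ∈ spineList → v ∈ spineList → (adj G u v ≡ true) ⇔ (Consec spineList u v ⊎ Consec spineList v u)
    adj⇔Consec u v u∈ v∈ with ∈-tabulate⁻ {f = spine} u∈ | ∈-tabulate⁻ {f = spine} v∈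
    ... | i , refl | j , refl = mk⇔ to from
      where
      to : adj G (spine i) (spine j) ≡ true → Consec spineList (spine i) (spine j) ⊎ Consec spineList (spine j) (spine i)
      to e with edge {spine i} {spine j} e
      ... | climb i′ j′ e₁ e₂ x rewrite spine-injective e₁ | spine-injective e₂ = inj₁ (Consec-tabulate⁺ spine i′ j′ x)
      ... | descend i′ j′ e₁ e₂ x rewrite spine-injective e₁ | spine-injective e₂ = inj₂ (Consec-tabulate⁺ spine j′ i′ x)
      ... | hang _ j′ _ e₂ _ = ⊥-elim (spine≢leaf j j′ e₂)
      ... | unhang _ j′ e₁ _ _ = ⊥-elim (spine≢leaf i j′ e₁)
      from : Consec spineList (spine i) (spine j) ⊎ Consec spineList (spine j) (spine i) → adj G (spine i) (spine j) ≡ true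
      from (inj₁ c) with Consec-tabulate⁻ spine c
      ... | a , b , e₁ , e₂ , x rewrite spine-injective e₁ | spine-injective e₂ = edge⇒adj (climb a b refl refl x)
      from (inj₂ c) with Consec-tabulate⁻ spine c
      ... | a , b , e₁ , e₂ , x rewrite spine-injective e₁ | spine-injective e₂ = edge⇒adj (descend b a refl refl x)

    isCaterpillar : IsCaterpillar G
    isCaterpillar = (connected , acyclic) , spineList , ∈spine⇔nonleaf , tabulate⁺ spine-injective , adj⇔Consec


module Coloring (L' M d k' s : ℕ) where
  open Caterpillar L' M d public
  S : Vec ℕ (suc k')
  S = seqS (suc k') s

  far⇒DistGt : ∀ u v → u ≢ v → s + column u < column v + (row u + row v) → DistGt G u v s
  far⇒DistGt u v u≢v far l l≤s w = ℕₚ.<⇒≱ far (begin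
    column v + (row u + row v)   ≤⟨ walk-length-bound u≢v w ⟩
    column u + l                 ≤⟨ ℕₚ.+-monoʳ-≤ (column u) l≤s ⟩
    column u + s                 ≡⟨ ℕₚ.+-comm (column u) s ⟩
    s + column u                 ∎)
    where open ℕₚ.≤-Reasoning

  far⇒DistGt′ : ∀ u v → u ≢ v → s + column v < column u + (row u + row v) → DistGt G u v s
  far⇒DistGt′ u v u≢v far = DistGt-sym (far⇒DistGt v u (u≢v ∘ ≡.sym) (subst (λ z → s + column v < column u + z) (ℕₚ.+-comm (row u) (row v)) far))

  FirstClassIndependent : (V → ℕ) → (V → Set) → Set
  FirstClassIndependent cn P = ∀ u v → P u → P v → u ≢ v → cn u ≡ 0 → cn v ≡ 0 → adj G u v ≡ false

  LaterClassesPacked : (V → ℕ) → (V → Set) → Set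
  LaterClassesPacked cn P = ∀ u v → P u → P v → u ≢ v → cn u ≡ cn v → 0 < cn u → DistGt G u v s

  toColor : (cn : V → ℕ) → (∀ v → cn v < suc k') → V → Fin (suc k')
  toColor cn bounded v = fromℕ< (bounded v)

  toColor-packed : ∀ cn bounded (P : V → Set) → FirstClassIndependent cn P → LaterClassesPacked cn P →
    ∀ u v → P u → P v → u ≢ v → toColor cn bounded u ≡ toColor cn bounded v → DistGt G u v (lookup S (toColor cn bounded u))
  toColor-packed cn bounded P independent packed u v pu pv u≢v e with lookup-seqS (toColor cn bounded u)
  ... | inj₁ (u-first , S≡1) = subst (DistGt G u v) (≡.sym S≡1) (nonadjacent⇒DistGt₁ u≢v (independent u v pu pv u≢v cu≡0 cv≡0))
    where
    cu≡0 = trans (≡.sym (Finₚ.toℕ-fromℕ< (bounded u))) u-first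
    cv≡0 = trans (≡.sym (Finₚ.toℕ-fromℕ< (bounded v))) (trans (cong toℕ (≡.sym e)) u-first)
  ... | inj₂ (u-later , S≡s) = subst (DistGt G u v) (≡.sym S≡s) (packed u v pu pv u≢v cu≡cv (subst (0 <_) (Finₚ.toℕ-fromℕ< (bounded u)) u-later))
    where
    cu≡cv = trans (≡.sym (Finₚ.toℕ-fromℕ< (bounded u))) (trans (cong toℕ e) (Finₚ.toℕ-fromℕ< (bounded v)))

  colorable : ∀ cn j → j ≤ suc k' → (∀ v → cn v < j) →
              FirstClassIndependent cn (λ _ → ⊤) → LaterClassesPacked cn (λ _ → ⊤) → PackingColorable S G j
  colorable cn j j≤ cn<j independent packed =
    j≤ , toColor cn bounded , (λ v → subst (_< j) (≡.sym (Finₚ.toℕ-fromℕ< (bounded v))) (cn<j v)) ,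
    λ u v u≢v e → toColor-packed cn bounded (λ _ → ⊤) independent packed u v tt tt u≢v e
    where
    bounded = λ v → ℕₚ.≤-trans (cn<j v) j≤

  colorable-delete : ∀ cn j x → j ≤ suc k' → (∀ v → cn v < j) →
                     FirstClassIndependent cn (_≢ x) → LaterClassesPacked cn (_≢ x) → PackingColorable S (delete G x) j
  colorable-delete cn j x j≤ cn<j independent packed =
    restrict-coloring S G x j (toColor cn bounded) j≤ (λ v _ → subst (_< j) (≡.sym (Finₚ.toℕ-fromℕ< (bounded v))) (cn<j v))
      (toColor-packed cn bounded (_≢ x) independent packed)
    where
    bounded = λ v → ℕₚ.≤-trans (cn<j v) j≤

  InWindow : ℕ → ℕ → ℕ → V → Set
  InWindow lo hi off v = lo + row v ≤ column v + off × column v + row v ≤ hi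

  window : ∀ {lo hi off} u v → InWindow lo hi off u → InWindow lo hi off v → hi + off ≤ lo + s → Within G u v s
  window {lo} {hi} {off} u v (u-lo , u-hi) (v-lo , v-hi) narrow =
    within u v s (half u v u-hi v-lo , subst (λ z → column v + z ≤ column u + s) (ℕₚ.+-comm (row v) (row u)) (half v u v-hi u-lo))
    where
    half : ∀ x y → column x + row x ≤ hi → lo + row y ≤ column y + off → column x + (row x + row y) ≤ column y + s
    half x y x-hi y-lo = ℕₚ.+-cancelˡ-≤ lo _ _ (begin
      lo + (column x + (row x + row y))   ≡⟨ cong (lo +_) (≡.sym (ℕₚ.+-assoc (column x) (row x) (row y))) ⟩
      lo + ((column x + row x) + row y)   ≡⟨ x∙yz≈y∙xz lo _ (row y) ⟩
      (column x + row x) + (lo + row y)   ≤⟨ ℕₚ.+-mono-≤ x-hi y-lo ⟩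
      hi + (column y + off)               ≡⟨ x∙yz≈y∙xz hi (column y) off ⟩
      column y + (hi + off)               ≤⟨ ℕₚ.+-monoʳ-≤ (column y) narrow ⟩
      column y + (lo + s)                 ≡⟨ x∙yz≈y∙xz (column y) lo s ⟩
      lo + (column y + s)                 ∎)
      where open ℕₚ.≤-Reasoning

  byKindₛ : (Fin L → ℕ) → (Fin M → ℕ) → Fin L ⊎ Fin M → ℕ
  byKindₛ f g (inj₁ i) = f i
  byKindₛ f g (inj₂ j) = g j
  byKind : (Fin L → ℕ) → (Fin M → ℕ) → V → ℕ
  byKind f g v = byKindₛ f g (Fin.splitAt L v)
  byKind-spine : ∀ f g i → byKind f g (spine i) ≡ f i
  byKind-spine f g i rewrite splitAt-spine i = refl
  byKind-leaf : ∀ f g j → byKind f g (leaf j) ≡ g j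
  byKind-leaf f g j rewrite splitAt-leaf j = refl

  standard-colorable : L ≤ k' → PackingColorable S G (suc L)
  standard-colorable L≤k′ =
    colorable cn (suc L) (s≤s L≤k′) (bounded ∘ view) (λ u v _ _ → independent (view u) (view v)) (λ u v _ _ → packed (view u) (view v))
    where
    cn = byKind (λ i → suc (toℕ i)) (λ _ → 0)
    cn-spine : ∀ i → cn (spine i) ≡ suc (toℕ i)
    cn-spine = byKind-spine _ _
    cn-leaf : ∀ j → cn (leaf j) ≡ 0
    cn-leaf = byKind-leaf _ _
    bounded : ∀ {v} → View v → cn v < suc L
    bounded (spineᵛ i) rewrite cn-spine i = s≤s (Finₚ.toℕ<n i)
    bounded (leafᵛ j)  rewrite cn-leaf j  = s≤s z≤n
    independent : ∀ {u v} → View u → View v → u ≢ v → cn u ≡ 0 → cn v ≡ 0 → adj G u v ≡ false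
    independent (spineᵛ i) _          _ cu≡0 _    = ⊥-elim (ℕₚ.1+n≢0 (trans (≡.sym (cn-spine i)) cu≡0))
    independent (leafᵛ _)  (spineᵛ i) _ _    cv≡0 = ⊥-elim (ℕₚ.1+n≢0 (trans (≡.sym (cn-spine i)) cv≡0))
    independent (leafᵛ j)  (leafᵛ j′) _ _    _    = adj-leaf-leaf j j′
    packed : ∀ {u v} → View u → View v → u ≢ v → cn u ≡ cn v → 0 < cn u → DistGt G u v s
    packed (spineᵛ i) (spineᵛ i′) u≢v e _ =
      ⊥-elim (u≢v (cong spine (Finₚ.toℕ-injective (ℕₚ.suc-injective (trans (≡.sym (cn-spine i)) (trans e (cn-spine i′)))))))
    packed (spineᵛ i) (leafᵛ j)   _ e _    = ⊥-elim (ℕₚ.1+n≢0 (trans (≡.sym (cn-spine i)) (trans e (cn-leaf j))))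
    packed (leafᵛ j)  _           _ _ cu>0 = ⊥-elim (ℕₚ.<⇒≢ cu>0 (≡.sym (cn-leaf j)))

  squeeze : ℕ → ℕ → ℕ
  squeeze p i with ℕₚ.<-cmp i p
  ... | tri< _ _ _ = suc i
  ... | tri≈ _ _ _ = 0
  ... | tri> _ _ _ = i

  squeeze-zero : ∀ p i → squeeze p i ≡ 0 → i ≡ p
  squeeze-zero p i h with ℕₚ.<-cmp i p
  ... | tri< _ _ _ = ⊥-elim (ℕₚ.1+n≢0 h)
  ... | tri≈ _ e _ = e
  ... | tri> _ _ gt = ⊥-elim (ℕₚ.<⇒≢ (ℕₚ.≤-trans (s≤s z≤n) gt) (≡.sym h))

  squeeze-injective : ∀ p i j → squeeze p i ≡ squeeze p j → 0 < squeeze p i → i ≡ j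
  squeeze-injective p i j e pz with ℕₚ.<-cmp i p | ℕₚ.<-cmp j p
  ... | tri< _ _ _ | tri< _ _ _ = ℕₚ.suc-injective e
  ... | tri< a _ _ | tri> _ _ c = ⊥-elim (ℕₚ.<-irrefl refl (ℕₚ.≤-trans c (ℕₚ.≤-trans (ℕₚ.≤-reflexive (≡.sym e)) a)))
  ... | tri> _ _ c | tri< a _ _ = ⊥-elim (ℕₚ.<-irrefl refl (ℕₚ.≤-trans c (ℕₚ.≤-trans (ℕₚ.≤-reflexive e) a)))
  ... | tri> _ _ _ | tri> _ _ _ = e
  ... | tri≈ _ _ _ | _ = ⊥-elim (ℕₚ.<-irrefl refl pz)
  ... | tri< _ _ _ | tri≈ _ _ _ = ⊥-elim (ℕₚ.1+n≢0 e)
  ... | tri> _ _ c | tri≈ _ _ _ = ⊥-elim (ℕₚ.<⇒≢ (ℕₚ.≤-trans (s≤s z≤n) c) (≡.sym e))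

  squeeze-bound : ∀ p i → p < L → i < L → squeeze p i < L
  squeeze-bound p i pl il with ℕₚ.<-cmp i p
  ... | tri< a _ _ = ℕₚ.≤-trans (s≤s a) pl
  ... | tri≈ _ _ _ = s≤s z≤n
  ... | tri> _ _ _ = il

  -- Once x is gone spine p has no leaf left, so it can join color 1 and the spine needs one color fewer.
  squeezed-colorable : ∀ (p : Fin L) x → (∀ j → anchor j ≡ toℕ p → x ≡ leaf j ⊎ x ≡ spine p) → L ≤ suc k' →
                       PackingColorable S (delete G x) L
  squeezed-colorable p x only-x L≤ =
    colorable-delete cn L x L≤ (bounded ∘ view) (λ u v → independent (view u) (view v)) (λ u v _ _ → packed (view u) (view v))
    where
    cn = byKind (λ i → squeeze (toℕ p) (toℕ i)) (λ _ → 0)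
    cn-spine : ∀ i → cn (spine i) ≡ squeeze (toℕ p) (toℕ i)
    cn-spine = byKind-spine _ _
    cn-leaf : ∀ j → cn (leaf j) ≡ 0
    cn-leaf = byKind-leaf _ _
    bounded : ∀ {v} → View v → cn v < L
    bounded (spineᵛ i) rewrite cn-spine i = squeeze-bound (toℕ p) (toℕ i) (Finₚ.toℕ<n p) (Finₚ.toℕ<n i)
    bounded (leafᵛ j)  rewrite cn-leaf j  = s≤s z≤n
    spine-leaf : ∀ i j → spine i ≢ x → leaf j ≢ x → cn (spine i) ≡ 0 → adj G (spine i) (leaf j) ≡ false
    spine-leaf i j i≢x j≢x ci≡0 = ¬-not λ ij →
      [ j≢x ∘ ≡.sym , (λ x≡p → i≢x (trans (cong spine (Finₚ.toℕ-injective i≡p)) (≡.sym x≡p))) ]′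
        (only-x j (trans (≡ᵇ⇒≡′ (trans (≡.sym (adj-spine-leaf i j)) ij)) i≡p))
      where i≡p = squeeze-zero _ _ (trans (≡.sym (cn-spine i)) ci≡0)
    independent : ∀ {u v} → View u → View v → u ≢ x → v ≢ x → u ≢ v → cn u ≡ 0 → cn v ≡ 0 → adj G u v ≡ false
    independent (spineᵛ i) (spineᵛ i′) _ _ u≢v cu≡0 cv≡0 = ⊥-elim (u≢v (cong spine (Finₚ.toℕ-injective
      (trans (squeeze-zero _ _ (trans (≡.sym (cn-spine i)) cu≡0)) (≡.sym (squeeze-zero _ _ (trans (≡.sym (cn-spine i′)) cv≡0)))))))
    independent (spineᵛ i) (leafᵛ j)  u≢x v≢x _ cu≡0 _    = spine-leaf i j u≢x v≢x cu≡0
    independent (leafᵛ j)  (spineᵛ i) u≢x v≢x _ _    cv≡0 = trans (sym G (leaf j) (spine i)) (spine-leaf i j v≢x u≢x cv≡0)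
    independent (leafᵛ j)  (leafᵛ j′) _ _ _ _ _           = adj-leaf-leaf j j′
    packed : ∀ {u v} → View u → View v → u ≢ v → cn u ≡ cn v → 0 < cn u → DistGt G u v s
    packed (spineᵛ i) (spineᵛ i′) u≢v e cu>0 = ⊥-elim (u≢v (cong spine (Finₚ.toℕ-injective
      (squeeze-injective _ _ _ (trans (≡.sym (cn-spine i)) (trans e (cn-spine i′))) (subst (0 <_) (cn-spine i) cu>0)))))
    packed (spineᵛ i) (leafᵛ j)   _ e cu>0 = ⊥-elim (ℕₚ.<⇒≢ cu>0 (≡.sym (trans e (cn-leaf j))))
    packed (leafᵛ j)  _           _ _ cu>0 = ⊥-elim (ℕₚ.<⇒≢ cu>0 (≡.sym (cn-leaf j)))

  row≤1 : ∀ v → row v ≤ 1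
  row≤1 v with view v
  ... | spineᵛ i rewrite row-spine i = z≤n
  ... | leafᵛ j rewrite row-leaf j = s≤s z≤n

  column≤L′ : ∀ v → column v ≤ L'
  column≤L′ v with view v
  ... | spineᵛ i rewrite column-spine i = ℕₚ.≤-pred (Finₚ.toℕ<n i)
  ... | leafᵛ j rewrite column-leaf j = ℕₚ.m⊓n≤n _ L'

  all-within : suc (suc L') ≤ s → ∀ u v → Within G u v s
  all-within L′+2≤s u v = window {0} {suc L'} {1} u v (in-window u) (in-window v) (ℕₚ.≤-trans (ℕₚ.≤-reflexive (ℕₚ.+-comm (suc L') 1)) L′+2≤s)
    where
    in-window : ∀ v → InWindow 0 (suc L') 1 v
    in-window v = ℕₚ.≤-trans (row≤1 v) (ℕₚ.m≤n+m 1 _) ,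
                  ℕₚ.≤-trans (ℕₚ.+-mono-≤ (column≤L′ v) (row≤1 v)) (ℕₚ.≤-reflexive (ℕₚ.+-comm L' 1))


  -- Leaf j has key j and spine i shares the key i + d with its partner leaf in NonFirst, so a family of
  -- vertices with distinct keys consists of distinct vertices.
  keyₛ : Fin L ⊎ Fin M → ℕ
  keyₛ (inj₁ i) = toℕ i + d
  keyₛ (inj₂ j) = toℕ j

  key : V → ℕ
  key v = keyₛ (Fin.splitAt L v)

  key-spine : ∀ i → key (spine i) ≡ toℕ i + d
  key-spine i rewrite splitAt-spine i = refl

  key-leaf : ∀ j → key (leaf j) ≡ toℕ j
  key-leaf j rewrite splitAt-leaf j = refl

  near⇒many-colors-by-key : ∀ {j c} → IsPackingColoring S G j c → ∀ o q (f : Fin (suc q) → V) →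
                            (∀ a → key (f a) ≡ o + toℕ a) → (∀ a → 0 < toℕ (c (f a))) → (∀ a b → Within G (f a) (f b) s) → suc q < j
  near⇒many-colors-by-key coloring o q f key≡ nonfirst near = SeqSPacking.near-clique⇒colors coloring q f nonfirst distinct near
    where
    distinct : ∀ a b → a ≢ b → f a ≢ f b
    distinct a b a≢b fa≡fb = a≢b (Finₚ.toℕ-injective (ℕₚ.+-cancelˡ-≡ o _ _ (trans (≡.sym (key≡ a)) (trans (cong key fa≡fb) (key≡ b)))))

  leafAt : (x : ℕ) → .(x < M) → V
  leafAt x p = leaf (fromℕ< p)

  key-spineAt : ∀ x .(p : x < L) → key (spineAt x p) ≡ x + d
  key-spineAt x p = trans (key-spine _) (cong (_+ d) (Finₚ.toℕ-fromℕ< p))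
  key-leafAt : ∀ x .(p : x < M) → key (leafAt x p) ≡ x
  key-leafAt x p = trans (key-leaf _) (Finₚ.toℕ-fromℕ< p)
  column-leafAt : ∀ x .(p : x < M) → column (leafAt x p) ≡ (x ∸ d) ⊓ L'
  column-leafAt x p = trans (column-leaf _) (cong (λ z → (z ∸ d) ⊓ L') (Finₚ.toℕ-fromℕ< p))
  row-spineAt : ∀ x .(p : x < L) → row (spineAt x p) ≡ 0
  row-spineAt x p = row-spine (fromℕ< p)
  row-leafAt : ∀ x .(p : x < M) → row (leafAt x p) ≡ 1
  row-leafAt x p = row-leaf _

  anchor-leafAt : ∀ x .(p : x < M) → anchor (fromℕ< p) ≡ (x ∸ d) ⊓ L'
  anchor-leafAt x p = cong (λ z → (z ∸ d) ⊓ L') (Finₚ.toℕ-fromℕ< p)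

  anchor-middle : ∀ i → i < L → ((i + d) ∸ d) ⊓ L' ≡ i
  anchor-middle i lt = trans (cong (_⊓ L') (ℕₚ.m+n∸n≡m i d)) (ℕₚ.m≤n⇒m⊓n≡m (ℕₚ.≤-pred lt))

  spine-leaf-adj : ∀ x y .(p : x < L) .(q : y < M) → (y ∸ d) ⊓ L' ≡ x → adj G (spineAt x p) (leafAt y q) ≡ true
  spine-leaf-adj x y p q e = edge⇒adj (hang (fromℕ< p) (fromℕ< q) refl refl (trans (anchor-leafAt y q) (trans e (≡.sym (Finₚ.toℕ-fromℕ< p)))))

  -- Of spine i and its leaf i + d, which are adjacent, at least one avoids color 1.
  module NonFirst {j c} (coloring : IsPackingColoring S G j c) where
    pick′ : ∀ i → .(pL : i < L) → .(i + d < M) → Dec (toℕ (c (spineAt i pL)) ≡ 0) → V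
    pick′ i pL pM (yes _) = leafAt (i + d) pM
    pick′ i pL pM (no _)  = spineAt i pL

    pick : ∀ i → .(i < L) → .(i + d < M) → V
    pick i pL pM = pick′ i pL pM (toℕ (c (spineAt i pL)) ℕ.≟ 0)

    pick-spec : ∀ i (pL : i < L) (pM : i + d < M) →
                key (pick i pL pM) ≡ i + d × column (pick i pL pM) ≡ i × row (pick i pL pM) ≤ 1 × 0 < toℕ (c (pick i pL pM))
    pick-spec i pL pM = go (toℕ (c (spineAt i pL)) ℕ.≟ 0)
      where
      go : ∀ dd → key (pick′ i pL pM dd) ≡ i + d × column (pick′ i pL pM dd) ≡ i × row (pick′ i pL pM dd) ≤ 1 ×
                  0 < toℕ (c (pick′ i pL pM dd))
      go (yes h) = key-leafAt (i + d) pM , trans (column-leafAt (i + d) pM) (anchor-middle i pL) , ℕₚ.≤-reflexive (row-leafAt (i + d) pM) ,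
                   SeqSPacking.color₁-neighbor coloring (spine-leaf-adj i (i + d) pL pM (anchor-middle i pL)) h
      go (no h)  = key-spineAt i pL , column-spineAt i pL , ℕₚ.≤-trans (ℕₚ.≤-reflexive (row-spineAt i pL)) z≤n , ℕₚ.n≢0⇒n>0 h

    record Candidate (o lo hi off a : ℕ) : Set where
      constructor mkCandidate
      field
        vertex    : V
        key≡      : key vertex ≡ o + a
        nonfirst  : 0 < toℕ (c vertex)
        in-window : InWindow lo hi off vertex

    window-clique : ∀ {o lo hi off} q → (∀ (a : Fin (suc q)) → Candidate o lo hi off (toℕ a)) → hi + off ≤ lo + s → suc q < j
    window-clique {o} {lo} {hi} {off} q cand h =
      near⇒many-colors-by-key coloring o q (vertex ∘ cand) (key≡ ∘ cand) (nonfirst ∘ cand)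
        λ a b → window _ _ (in-window (cand a)) (in-window (cand b)) h
      where open Candidate

    candidate-pick : ∀ i (pL : i < L) (pM : i + d < M) {o a lo hi off} →
                     i + d ≡ o + a → lo + 1 ≤ i + off → i + 1 ≤ hi → Candidate o lo hi off a
    candidate-pick i pL pM {lo = lo} {hi} {off} e lo≤ ≤hi with pick-spec i pL pM
    ... | key≡ , column≡ , row≤1 , nonfirst = mkCandidate (pick i pL pM) (trans key≡ e) nonfirst $
      subst (λ z → lo + row (pick i pL pM) ≤ z + off) (≡.sym column≡) (ℕₚ.≤-trans (ℕₚ.+-monoʳ-≤ lo row≤1) lo≤) ,
      subst (λ z → z + row (pick i pL pM) ≤ hi) (≡.sym column≡) (ℕₚ.≤-trans (ℕₚ.+-monoʳ-≤ i row≤1) ≤hi)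

    candidate-leaf : ∀ y (pM : y < M) p {o a lo hi off} → (y ∸ d) ⊓ L' ≡ p → y ≡ o + a → 0 < toℕ (c (leafAt y pM)) →
                     lo + 1 ≤ p + off → p + 1 ≤ hi → Candidate o lo hi off a
    candidate-leaf y pM p {lo = lo} {hi} {off} anchor≡ e nonfirst lo≤ ≤hi = mkCandidate (leafAt y pM) (trans (key-leafAt y pM) e) nonfirst $
      subst₂ (λ w z → lo + w ≤ z + off) (≡.sym (row-leafAt y pM)) (≡.sym (trans (column-leafAt y pM) anchor≡)) lo≤ ,
      subst₂ (λ z w → z + w ≤ hi) (≡.sym (trans (column-leafAt y pM) anchor≡)) (≡.sym (row-leafAt y pM)) ≤hi

    candidate-spine : ∀ x (pL : x < L) {o a lo hi off} → x + d ≡ o + a → 0 < toℕ (c (spineAt x pL)) →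
                      lo + 0 ≤ x + off → x + 0 ≤ hi → Candidate o lo hi off a
    candidate-spine x pL {lo = lo} {hi} {off} e nonfirst lo≤ ≤hi = mkCandidate (spineAt x pL) (trans (key-spineAt x pL) e) nonfirst $
      subst₂ (λ w z → lo + w ≤ z + off) (≡.sym (row-spineAt x pL)) (≡.sym (column-spineAt x pL)) lo≤ ,
      subst₂ (λ z w → z + w ≤ hi) (≡.sym (column-spineAt x pL)) (≡.sym (row-spineAt x pL)) ≤hi

  -- Sufficient conditions for a coloring of G − x with color numbers cn (number 0 is color 1): color 1 holds
  -- the spine vertices at the columns in A and the leaves at the other columns; spine i may take number i ∸ δ
  -- up to U; number Y is shared by the spine vertex at Y-column and the paired leaf of rank 0, and number Z by
  -- leaf z₀ and the paired leaf of rank 1.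
  module ClassCertificate (cn : V → ℕ) (x : V) (A : ℕ → Set) (A-apart : ∀ p q → A p → A q → q ≢ suc p)
              (δ U Y Z : ℕ) (U<Y : U < Y) (Y<Z : Y < Z)
              (Y-column : ℕ) (Paired : Fin M → Set) (rank : Fin M → ℕ) (z₀ : Fin M)
              (rank-injective : ∀ j j′ → Paired j → Paired j′ → leaf j ≢ x → leaf j′ ≢ x → rank j ≡ rank j′ → j ≡ j′)
              (Y-far : ∀ i j → toℕ i ≡ Y-column → Paired j → DistGt G (spine i) (leaf j) s)
              (Z-far : ∀ j → Paired j → DistGt G (leaf z₀) (leaf j) s) where

    InFirstClass : V → Set
    InFirstClass v = (row v ≡ 0 × A (column v)) ⊎ (row v ≡ 1 × ¬ A (column v))

    data Class (v : V) : Set where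
      first : cn v ≡ 0 → InFirstClass v → Class v
      shifted : ∀ i → v ≡ spine i → cn v ≡ toℕ i ∸ δ → δ < toℕ i → cn v ≤ U → Class v
      Y-spine : ∀ i → v ≡ spine i → toℕ i ≡ Y-column → cn v ≡ Y → Class v
      Y-leaf : ∀ j → v ≡ leaf j → Paired j → rank j ≡ 0 → cn v ≡ Y → Class v
      Z-leaf₀ : v ≡ leaf z₀ → cn v ≡ Z → Class v
      Z-leaf : ∀ j → v ≡ leaf j → Paired j → rank j ≡ 1 → cn v ≡ Z → Class v

    0<Y : 0 < Y
    0<Y = ℕₚ.≤-trans (s≤s z≤n) U<Y
    0<Z : 0 < Z
    0<Z = ℕₚ.<-trans 0<Y Y<Z

    first-class : ∀ {v} → Class v → cn v ≡ 0 → InFirstClass v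
    first-class (first _ in-first)     _   = in-first
    first-class (shifted i _ e δ<i _)  cv≡0 = ⊥-elim (ℕₚ.<⇒≢ (ℕₚ.m<n⇒0<n∸m δ<i) (≡.sym (trans (≡.sym e) cv≡0)))
    first-class (Y-spine _ _ _ e)      cv≡0 = ⊥-elim (ℕₚ.<⇒≢ 0<Y (≡.sym (trans (≡.sym e) cv≡0)))
    first-class (Y-leaf _ _ _ _ e)     cv≡0 = ⊥-elim (ℕₚ.<⇒≢ 0<Y (≡.sym (trans (≡.sym e) cv≡0)))
    first-class (Z-leaf₀ _ e)          cv≡0 = ⊥-elim (ℕₚ.<⇒≢ 0<Z (≡.sym (trans (≡.sym e) cv≡0)))
    first-class (Z-leaf _ _ _ _ e)     cv≡0 = ⊥-elim (ℕₚ.<⇒≢ 0<Z (≡.sym (trans (≡.sym e) cv≡0)))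

    first-class-nonadjacent : ∀ u v → InFirstClass u → InFirstClass v → Edge u v → ⊥
    first-class-nonadjacent u v zu zv (climb i j refl refl e) with zu | zv
    ... | inj₁ (_ , au) | inj₁ (_ , av) = A-apart _ _ au av (trans (column-spine j) (trans e (cong suc (≡.sym (column-spine i)))))
    ... | inj₂ (w1 , _) | _ = ℕₚ.0≢1+n (trans (≡.sym (row-spine i)) w1)
    ... | _ | inj₂ (w1 , _) = ℕₚ.0≢1+n (trans (≡.sym (row-spine j)) w1)
    first-class-nonadjacent u v zu zv (descend i j refl refl e) with zu | zv
    ... | inj₁ (_ , au) | inj₁ (_ , av) = A-apart _ _ av au (trans (column-spine i) (trans e (cong suc (≡.sym (column-spine j)))))
    ... | inj₂ (w1 , _) | _ = ℕₚ.0≢1+n (trans (≡.sym (row-spine i)) w1)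
    ... | _ | inj₂ (w1 , _) = ℕₚ.0≢1+n (trans (≡.sym (row-spine j)) w1)
    first-class-nonadjacent u v zu zv (hang i j refl refl e) with zu | zv
    ... | inj₂ (w1 , _) | _ = ℕₚ.0≢1+n (trans (≡.sym (row-spine i)) w1)
    ... | _ | inj₁ (w0 , _) = ℕₚ.0≢1+n (trans (≡.sym w0) (row-leaf j))
    ... | inj₁ (_ , au) | inj₂ (_ , nav) = nav (subst A (trans (column-spine i) (trans (≡.sym e) (≡.sym (column-leaf j)))) au)
    first-class-nonadjacent u v zu zv (unhang i j refl refl e) with zu | zv
    ... | _ | inj₂ (w1 , _) = ℕₚ.0≢1+n (trans (≡.sym (row-spine i)) w1)
    ... | inj₁ (w0 , _) | _ = ℕₚ.0≢1+n (trans (≡.sym w0) (row-leaf j))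
    ... | inj₂ (_ , nau) | inj₁ (_ , av) = nau (subst A (trans (column-spine i) (trans (≡.sym e) (≡.sym (column-leaf j)))) av)

    module Certified (classify : ∀ v → v ≢ x → Class v) where
      independent : FirstClassIndependent cn (_≢ x)
      independent u v u≢x v≢x _ cu≡0 cv≡0 = ¬-not λ uv →
        first-class-nonadjacent u v (first-class (classify u u≢x) cu≡0) (first-class (classify v v≢x) cv≡0) (edge {u} {v} uv)

      ≤U⇒≢Y : ∀ {n} → n ≤ U → n ≢ Y
      ≤U⇒≢Y n≤U = ℕₚ.<⇒≢ (ℕₚ.≤-<-trans n≤U U<Y)

      ≤U⇒≢Z : ∀ {n} → n ≤ U → n ≢ Z
      ≤U⇒≢Z n≤U = ℕₚ.<⇒≢ (ℕₚ.<-trans (ℕₚ.≤-<-trans n≤U U<Y) Y<Z)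

      Y≢Z : Y ≢ Z
      Y≢Z = ℕₚ.<⇒≢ Y<Z

      packed′ : ∀ {u v} → u ≢ x → v ≢ x → u ≢ v → cn u ≡ cn v → 0 < cn u → Class u → Class v → DistGt G u v s
      packed′ _ _ _ _ cu>0 (first cu≡0 _) _ = ⊥-elim (ℕₚ.<⇒≢ cu>0 (≡.sym cu≡0))
      packed′ _ _ _ e cu>0 _ (first cv≡0 _) = ⊥-elim (ℕₚ.<⇒≢ cu>0 (≡.sym (trans e cv≡0)))
      packed′ _ _ u≢v e _ (shifted i refl c₁ δ<i _) (shifted i′ refl c₂ δ<i′ _) =
        ⊥-elim (u≢v (cong spine (Finₚ.toℕ-injective (ℕₚ.∸-cancelʳ-≡ (ℕₚ.<⇒≤ δ<i) (ℕₚ.<⇒≤ δ<i′) (trans (≡.sym c₁) (trans e c₂))))))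
      packed′ _ _ _ e _ (shifted _ _ _ _ ≤U) (Y-spine _ _ _ c₂)   = ⊥-elim (≤U⇒≢Y ≤U (trans e c₂))
      packed′ _ _ _ e _ (shifted _ _ _ _ ≤U) (Y-leaf _ _ _ _ c₂)  = ⊥-elim (≤U⇒≢Y ≤U (trans e c₂))
      packed′ _ _ _ e _ (shifted _ _ _ _ ≤U) (Z-leaf₀ _ c₂)       = ⊥-elim (≤U⇒≢Z ≤U (trans e c₂))
      packed′ _ _ _ e _ (shifted _ _ _ _ ≤U) (Z-leaf _ _ _ _ c₂)  = ⊥-elim (≤U⇒≢Z ≤U (trans e c₂))
      packed′ _ _ _ e _ (Y-spine _ _ _ c₁) (shifted _ _ _ _ ≤U)   = ⊥-elim (≤U⇒≢Y ≤U (trans (≡.sym e) c₁))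
      packed′ _ _ _ e _ (Y-leaf _ _ _ _ c₁) (shifted _ _ _ _ ≤U)  = ⊥-elim (≤U⇒≢Y ≤U (trans (≡.sym e) c₁))
      packed′ _ _ _ e _ (Z-leaf₀ _ c₁) (shifted _ _ _ _ ≤U)       = ⊥-elim (≤U⇒≢Z ≤U (trans (≡.sym e) c₁))
      packed′ _ _ _ e _ (Z-leaf _ _ _ _ c₁) (shifted _ _ _ _ ≤U)  = ⊥-elim (≤U⇒≢Z ≤U (trans (≡.sym e) c₁))
      packed′ _ _ _ e _ (Y-spine _ _ _ c₁) (Z-leaf₀ _ c₂)         = ⊥-elim (Y≢Z (trans (≡.sym c₁) (trans e c₂)))
      packed′ _ _ _ e _ (Y-spine _ _ _ c₁) (Z-leaf _ _ _ _ c₂)    = ⊥-elim (Y≢Z (trans (≡.sym c₁) (trans e c₂)))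
      packed′ _ _ _ e _ (Y-leaf _ _ _ _ c₁) (Z-leaf₀ _ c₂)        = ⊥-elim (Y≢Z (trans (≡.sym c₁) (trans e c₂)))
      packed′ _ _ _ e _ (Y-leaf _ _ _ _ c₁) (Z-leaf _ _ _ _ c₂)   = ⊥-elim (Y≢Z (trans (≡.sym c₁) (trans e c₂)))
      packed′ _ _ _ e _ (Z-leaf₀ _ c₁) (Y-spine _ _ _ c₂)         = ⊥-elim (Y≢Z (trans (≡.sym c₂) (trans (≡.sym e) c₁)))
      packed′ _ _ _ e _ (Z-leaf₀ _ c₁) (Y-leaf _ _ _ _ c₂)        = ⊥-elim (Y≢Z (trans (≡.sym c₂) (trans (≡.sym e) c₁)))
      packed′ _ _ _ e _ (Z-leaf _ _ _ _ c₁) (Y-spine _ _ _ c₂)    = ⊥-elim (Y≢Z (trans (≡.sym c₂) (trans (≡.sym e) c₁)))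
      packed′ _ _ _ e _ (Z-leaf _ _ _ _ c₁) (Y-leaf _ _ _ _ c₂)   = ⊥-elim (Y≢Z (trans (≡.sym c₂) (trans (≡.sym e) c₁)))
      packed′ _ _ u≢v _ _ (Y-spine i refl i≡ _) (Y-spine i′ refl i′≡ _) = ⊥-elim (u≢v (cong spine (Finₚ.toℕ-injective (trans i≡ (≡.sym i′≡)))))
      packed′ _ _ _ _ _ (Y-spine i refl i≡ _) (Y-leaf j refl pj _ _) = Y-far i j i≡ pj
      packed′ _ _ _ _ _ (Y-leaf j refl pj _ _) (Y-spine i refl i≡ _) = DistGt-sym (Y-far i j i≡ pj)
      packed′ u≢x v≢x u≢v _ _ (Y-leaf j refl pj r₁ _) (Y-leaf j′ refl pj′ r₂ _) =
        ⊥-elim (u≢v (cong leaf (rank-injective j j′ pj pj′ u≢x v≢x (trans r₁ (≡.sym r₂)))))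
      packed′ _ _ u≢v _ _ (Z-leaf₀ refl _) (Z-leaf₀ refl _) = ⊥-elim (u≢v refl)
      packed′ _ _ _ _ _ (Z-leaf₀ refl _) (Z-leaf j refl pj _ _) = Z-far j pj
      packed′ _ _ _ _ _ (Z-leaf j refl pj _ _) (Z-leaf₀ refl _) = DistGt-sym (Z-far j pj)
      packed′ u≢x v≢x u≢v _ _ (Z-leaf j refl pj r₁ _) (Z-leaf j′ refl pj′ r₂ _) =
        ⊥-elim (u≢v (cong leaf (rank-injective j j′ pj pj′ u≢x v≢x (trans r₁ (≡.sym r₂)))))

      packed : LaterClassesPacked cn (_≢ x)
      packed u v u≢x v≢x u≢v e cu>0 = packed′ u≢x v≢x u≢v e cu>0 (classify u u≢x) (classify v v≢x)

  critical : L ≤ k' → (∀ j → j < suc L → ¬ PackingColorable S G j) → (∀ j → PackingColorable S (delete G (leaf j)) L) →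
             Critical S G (suc L)
  critical L≤k′ needs-L+1 leaf-deletion = (standard-colorable L≤k′ , needs-L+1) , λ u → deletion (view u)
    where
    deletion : ∀ {u} → View u → ∃ λ j → j < suc L × ChiS S (delete G u) j
    deletion (spineᵛ p) = colorable⇒chiS< S (delete G (spine p)) (squeezed-colorable p (spine p) (λ _ _ → inj₂ refl) (ℕₚ.≤-trans L≤k′ (ℕₚ.n≤1+n k'))) ℕₚ.≤-refl
    deletion (leafᵛ j)  = colorable⇒chiS< S (delete G (leaf j)) (leaf-deletion j) ℕₚ.≤-refl

-- The comb: spine 0 … t and one leaf on every spine vertex.  Its diameter t + 2 is at most s, and every
-- spine position carries a vertex of color ≠ 1, so t + 1 colors besides color 1 are needed.
module CriticalComb (t s : ℕ) (1≤t : 1 ≤ t) (t+2≤s : suc (suc t) ≤ s) where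
  open Coloring t (suc t) 0 (suc t) s

  anchor-comb : ∀ (j : Fin (suc t)) → anchor j ≡ toℕ j
  anchor-comb j = ℕₚ.m≤n⇒m⊓n≡m (ℕₚ.≤-pred (Finₚ.toℕ<n j))

  isCaterpillar : IsCaterpillar G
  isCaterpillar = SpineOfNonLeaves.isCaterpillar 1≤t Fin.zero refl (Fin.fromℕ t) (trans (anchor-comb (Fin.fromℕ t)) (Finₚ.toℕ-fromℕ t))

  needs-t+2 : ∀ j → j < suc (suc t) → ¬ PackingColorable S G j
  needs-t+2 j j<t+2 (_ , c , coloring) =
    ℕₚ.<⇒≱ j<t+2 (near⇒many-colors-by-key coloring 0 t f key-f nonfirst λ a b → all-within t+2≤s (f a) (f b))
    where
    open NonFirst coloring
    at : (a : Fin (suc t)) → toℕ a < suc t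
    at a = Finₚ.toℕ<n a
    at′ : (a : Fin (suc t)) → toℕ a + 0 < suc t
    at′ a = subst (_< suc t) (≡.sym (ℕₚ.+-identityʳ (toℕ a))) (Finₚ.toℕ<n a)
    f : Fin (suc t) → V
    f a = pick (toℕ a) (at a) (at′ a)
    key-f : ∀ a → key (f a) ≡ toℕ a
    key-f a = trans (proj₁ (pick-spec (toℕ a) (at a) (at′ a))) (ℕₚ.+-identityʳ (toℕ a))
    nonfirst : ∀ a → 0 < toℕ (c (f a))
    nonfirst a = proj₂ (proj₂ (proj₂ (pick-spec (toℕ a) (at a) (at′ a))))

  leaf-deletion : ∀ j → PackingColorable S (delete G (leaf j)) (suc t)
  leaf-deletion j = squeezed-colorable j (leaf j) (λ j′ e → inj₁ (cong leaf (Finₚ.toℕ-injective (trans (≡.sym e) (anchor-comb j′))))) (ℕₚ.n≤1+n _)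

  critical-comb : Critical S G (suc (suc t))
  critical-comb = critical ℕₚ.≤-refl needs-t+2 leaf-deletion

two-values : ∀ m a → m ≤ a → a < 2 + m → a ≡ m ⊎ a ≡ suc m
two-values m a m≤a a<2+m with ℕₚ.m≤n⇒m<n∨m≡n m≤a
... | inj₂ m≡a = inj₁ (≡.sym m≡a)
... | inj₁ m<a = inj₂ (ℕₚ.≤-antisym (ℕₚ.≤-pred a<2+m) m<a)

-- The caterpillar with spine 0 … s − 1 (s = r + 3), one leaf on every spine vertex and a second leaf on the
-- last one.  Whether or not the last spine vertex has color 1, there are s vertices avoiding color 1 and
-- pairwise at distance at most s.
module CriticalS+1 (r : ℕ) where
  s : ℕ
  s = 3 + r
  open Coloring (2 + r) (4 + r) 0 (3 + r) s

  anchor-left : ∀ (j : Fin (4 + r)) → toℕ j ≤ 2 + r → anchor j ≡ toℕ j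
  anchor-left j j≤ = ℕₚ.m≤n⇒m⊓n≡m j≤

  anchor-right : ∀ (j : Fin (4 + r)) → 2 + r ≤ toℕ j → anchor j ≡ 2 + r
  anchor-right j j≥ = ℕₚ.m≥n⇒m⊓n≡n j≥

  isCaterpillar : IsCaterpillar G
  isCaterpillar = SpineOfNonLeaves.isCaterpillar (s≤s z≤n) Fin.zero refl (Fin.fromℕ (3 + r))
                    (anchor-right (Fin.fromℕ (3 + r)) (ℕₚ.≤-trans (ℕₚ.n≤1+n _) (ℕₚ.≤-reflexive (≡.sym (Finₚ.toℕ-fromℕ (3 + r))))))

  last : V
  last = spineAt (2 + r) ℕₚ.≤-refl

  needs-s+1 : ∀ j → j < 4 + r → ¬ PackingColorable S G j
  needs-s+1 j j<s+1 (_ , c , coloring) with toℕ (c last) ℕ.≟ 0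
  ... | yes last-first = ℕₚ.<⇒≱ j<s+1 (window-clique {1} {1} {3 + r} {1} (2 + r) candidate (ℕₚ.≤-reflexive (ℕₚ.+-comm (3 + r) 1)))
    where
    open NonFirst coloring
    candidate : ∀ a → Candidate 1 1 (3 + r) 1 (toℕ a)
    candidate a with toℕ a ℕ.≤? r
    ... | yes a≤r = candidate-pick (1 + toℕ a) (s≤s (s≤s (ℕₚ.≤-trans a≤r (ℕₚ.n≤1+n r)))) (subst (_< 4 + r) (≡.sym (ℕₚ.+-identityʳ _)) (s≤s (Finₚ.toℕ<n a)))
                      (ℕₚ.+-identityʳ _) (s≤s (ℕₚ.m≤n+m 1 (toℕ a))) (s≤s (ℕₚ.≤-trans (ℕₚ.≤-reflexive (ℕₚ.+-comm (toℕ a) 1)) (s≤s (ℕₚ.≤-trans a≤r (ℕₚ.n≤1+n r)))))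
    ... | no a>r  = candidate-leaf (1 + toℕ a) (s≤s (Finₚ.toℕ<n a)) (2 + r) anchor≡ refl
                      (SeqSPacking.color₁-neighbor coloring (spine-leaf-adj (2 + r) (1 + toℕ a) ℕₚ.≤-refl (s≤s (Finₚ.toℕ<n a)) anchor≡) last-first)
                      (s≤s (s≤s z≤n)) (ℕₚ.≤-reflexive (ℕₚ.+-comm (2 + r) 1))
      where
      anchor≡ : (1 + toℕ a) ⊓ (2 + r) ≡ 2 + r
      anchor≡ = ℕₚ.m≥n⇒m⊓n≡n (s≤s (ℕₚ.≰⇒> a>r))
  ... | no last-nonfirst = ℕₚ.<⇒≱ j<s+1 (window-clique {0} {0} {2 + r} {1} (2 + r) candidate (ℕₚ.≤-reflexive (ℕₚ.+-comm (2 + r) 1)))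
    where
    open NonFirst coloring
    candidate : ∀ a → Candidate 0 0 (2 + r) 1 (toℕ a)
    candidate a with toℕ a ℕ.≤? 1 + r
    ... | yes a≤1+r = candidate-pick (toℕ a) (s≤s (ℕₚ.≤-trans a≤1+r (ℕₚ.n≤1+n _))) (subst (_< 4 + r) (≡.sym (ℕₚ.+-identityʳ _)) (ℕₚ.≤-trans (Finₚ.toℕ<n a) (ℕₚ.n≤1+n _)))
                        (ℕₚ.+-identityʳ _) (ℕₚ.m≤n+m 1 (toℕ a)) (ℕₚ.≤-trans (ℕₚ.≤-reflexive (ℕₚ.+-comm (toℕ a) 1)) (s≤s a≤1+r))
    ... | no a>1+r  = candidate-spine (2 + r) ℕₚ.≤-refl (trans (ℕₚ.+-identityʳ _) (ℕₚ.≤-antisym (ℕₚ.≰⇒> a>1+r) (ℕₚ.≤-pred (Finₚ.toℕ<n a))))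
                        (ℕₚ.n≢0⇒n>0 last-nonfirst) z≤n (ℕₚ.≤-reflexive (ℕₚ.+-identityʳ _))

  ends-nonconsecutive : ∀ {a b} → a ≡ 0 ⊎ a ≡ 2 + r → b ≡ 0 ⊎ b ≡ 2 + r → b ≢ suc a
  ends-nonconsecutive (inj₁ refl) (inj₁ refl) ()
  ends-nonconsecutive (inj₁ refl) (inj₂ refl) e = ℕₚ.1+n≢0 (ℕₚ.suc-injective e)
  ends-nonconsecutive (inj₂ refl) (inj₁ refl) ()
  ends-nonconsecutive (inj₂ refl) (inj₂ refl) e = ℕₚ.1+n≢n (≡.sym e)

  -- Color 1 on spine 0, spine s − 1 and the inner leaves, colors 2 … s − 1 on spine 1 … s − 2, and color s
  -- on leaf 0 and the surviving right leaf, which are at distance s + 1.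
  module RightLeafDeletion (jx : Fin (4 + r)) (jx≥ : 2 + r ≤ toℕ jx) where
    x = leaf jx

    data SpineCase (i : ℕ) : ℕ → Set where
      last-spine : i ≡ 2 + r → SpineCase i 0
      other      : i ≢ 2 + r → SpineCase i i

    spine-case : ∀ i → Σ ℕ (SpineCase i)
    spine-case i with i ℕ.≟ 2 + r
    ... | yes i≡ = _ , last-spine i≡
    ... | no i≢  = _ , other i≢

    data LeafCase (j : ℕ) : ℕ → Set where
      outer : j ≡ 0 ⊎ 2 + r ≤ j → LeafCase j (2 + r)
      inner : j ≢ 0 → j < 2 + r → LeafCase j 0

    leaf-case : ∀ j → Σ ℕ (LeafCase j)
    leaf-case j with j ℕ.≟ 0 | 2 + r ℕ.≤? j
    ... | yes j≡0 | _      = _ , outer (inj₁ j≡0)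
    ... | no _    | yes j≥ = _ , outer (inj₂ j≥)
    ... | no j≢0  | no j<  = _ , inner j≢0 (ℕₚ.≰⇒> j<)

    cn : V → ℕ
    cn = byKind (λ i → proj₁ (spine-case (toℕ i))) (λ j → proj₁ (leaf-case (toℕ j)))

    cn-spine : ∀ i → cn (spine i) ≡ proj₁ (spine-case (toℕ i))
    cn-spine = byKind-spine _ _

    cn-leaf : ∀ j → cn (leaf j) ≡ proj₁ (leaf-case (toℕ j))
    cn-leaf = byKind-leaf _ _

    bounded : ∀ {v} → View v → cn v < 3 + r
    bounded (spineᵛ i) rewrite cn-spine i with spine-case (toℕ i)
    ... | _ , last-spine _ = s≤s z≤n
    ... | _ , other _      = Finₚ.toℕ<n i
    bounded (leafᵛ j) rewrite cn-leaf j with leaf-case (toℕ j)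
    ... | _ , outer _   = ℕₚ.≤-refl
    ... | _ , inner _ _ = s≤s z≤n

    spine-first : ∀ i → cn (spine i) ≡ 0 → toℕ i ≡ 0 ⊎ toℕ i ≡ 2 + r
    spine-first i ci≡0 rewrite cn-spine i with spine-case (toℕ i)
    ... | _ , last-spine i≡ = inj₂ i≡
    ... | _ , other _       = inj₁ ci≡0

    spine-later : ∀ i → 0 < cn (spine i) → cn (spine i) ≡ toℕ i × toℕ i ≢ 2 + r
    spine-later i ci>0 rewrite cn-spine i with spine-case (toℕ i)
    ... | _ , last-spine _ = ⊥-elim (ℕₚ.<-irrefl refl ci>0)
    ... | _ , other i≢     = refl , i≢

    leaf-first : ∀ j → cn (leaf j) ≡ 0 → toℕ j ≢ 0 × toℕ j < 2 + r
    leaf-first j cj≡0 rewrite cn-leaf j with leaf-case (toℕ j)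
    ... | _ , outer _       = ⊥-elim (ℕₚ.1+n≢0 cj≡0)
    ... | _ , inner j≢0 j<  = j≢0 , j<

    leaf-later : ∀ j → 0 < cn (leaf j) → cn (leaf j) ≡ 2 + r × (toℕ j ≡ 0 ⊎ 2 + r ≤ toℕ j)
    leaf-later j cj>0 rewrite cn-leaf j with leaf-case (toℕ j)
    ... | _ , outer outer-j = refl , outer-j
    ... | _ , inner _ _     = ⊥-elim (ℕₚ.<-irrefl refl cj>0)

    spine-leaf-independent : ∀ i j → cn (spine i) ≡ 0 → cn (leaf j) ≡ 0 → adj G (spine i) (leaf j) ≡ false
    spine-leaf-independent i j ci≡0 cj≡0 = ¬-not λ ij →
      different (≡.sym (anchor-left j (ℕₚ.<⇒≤ (proj₂ (leaf-first j cj≡0))))) (≡ᵇ⇒≡′ (trans (≡.sym (adj-spine-leaf i j)) ij))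
      where
      different : toℕ j ≡ anchor j → anchor j ≡ toℕ i → ⊥
      different j≡ ≡i with spine-first i ci≡0 | leaf-first j cj≡0
      ... | inj₁ i≡0 | j≢0 , _ = j≢0 (trans j≡ (trans ≡i i≡0))
      ... | inj₂ i≡  | _ , j<  = ℕₚ.<⇒≢ j< (trans j≡ (trans ≡i i≡))

    independent : ∀ {u v} → View u → View v → u ≢ x → v ≢ x → u ≢ v → cn u ≡ 0 → cn v ≡ 0 → adj G u v ≡ false
    independent (spineᵛ i) (spineᵛ i′) _ _ _ ci≡0 ci′≡0 = ¬-not λ ii′ → nonconsecutive (edge {spine i} {spine i′} ii′)
      where
      nonconsecutive : Edge (spine i) (spine i′) → ⊥
      nonconsecutive (climb a b e₁ e₂ e) rewrite spine-injective e₁ | spine-injective e₂ =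
        ends-nonconsecutive (spine-first _ ci≡0) (spine-first _ ci′≡0) e
      nonconsecutive (descend a b e₁ e₂ e) rewrite spine-injective e₁ | spine-injective e₂ =
        ends-nonconsecutive (spine-first _ ci′≡0) (spine-first _ ci≡0) e
      nonconsecutive (hang _ b _ e₂ _)   = spine≢leaf i′ b e₂
      nonconsecutive (unhang _ b e₁ _ _) = spine≢leaf i b e₁
    independent (spineᵛ i) (leafᵛ j)  _ _ _ ci≡0 cj≡0 = spine-leaf-independent i j ci≡0 cj≡0
    independent (leafᵛ j)  (spineᵛ i) _ _ _ cj≡0 ci≡0 = trans (sym G (leaf j) (spine i)) (spine-leaf-independent i j ci≡0 cj≡0)
    independent (leafᵛ j)  (leafᵛ j′) _ _ _ _ _        = adj-leaf-leaf j j′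

    s<ends-distance : suc (s + 0) ≤ 2 + r + 2
    s<ends-distance rewrite ℕₚ.+-identityʳ s | ℕₚ.+-comm (2 + r) 2 = ℕₚ.≤-refl

    leaf₀-far : ∀ j j′ → toℕ j ≡ 0 → 2 + r ≤ toℕ j′ → DistGt G (leaf j) (leaf j′) s
    leaf₀-far j j′ j≡0 j′≥ = far⇒DistGt (leaf j) (leaf j′) j≢j′ far
      where
      j≢j′ : leaf j ≢ leaf j′
      j≢j′ e = ℕₚ.<⇒≢ (ℕₚ.≤-trans (s≤s z≤n) j′≥) (trans (≡.sym j≡0) (cong toℕ (leaf-injective e)))
      far : s + column (leaf j) < column (leaf j′) + (row (leaf j) + row (leaf j′))
      far rewrite column-leaf j | column-leaf j′ | row-leaf j | row-leaf j′ | j≡0 | anchor-right j′ j′≥ = s<ends-distance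

    right-leaves-unique : ∀ j j′ → j ≢ j′ → leaf j ≢ x → leaf j′ ≢ x → 2 + r ≤ toℕ j → 2 + r ≤ toℕ j′ → ⊥
    right-leaves-unique j j′ j≢j′ j≢x j′≢x j≥ j′≥ =
      pigeon (two-values _ _ j≥ (Finₚ.toℕ<n j)) (two-values _ _ j′≥ (Finₚ.toℕ<n j′)) (two-values _ _ jx≥ (Finₚ.toℕ<n jx))
      where
      pigeon : _ → _ → _ → ⊥
      pigeon (inj₁ e₁) (inj₁ e₂) _         = j≢j′ (Finₚ.toℕ-injective (trans e₁ (≡.sym e₂)))
      pigeon (inj₂ e₁) (inj₂ e₂) _         = j≢j′ (Finₚ.toℕ-injective (trans e₁ (≡.sym e₂)))
      pigeon (inj₁ e₁) _         (inj₁ e₃) = j≢x (cong leaf (Finₚ.toℕ-injective (trans e₁ (≡.sym e₃))))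
      pigeon (inj₂ e₁) _         (inj₂ e₃) = j≢x (cong leaf (Finₚ.toℕ-injective (trans e₁ (≡.sym e₃))))
      pigeon _         (inj₁ e₂) (inj₁ e₃) = j′≢x (cong leaf (Finₚ.toℕ-injective (trans e₂ (≡.sym e₃))))
      pigeon _         (inj₂ e₂) (inj₂ e₃) = j′≢x (cong leaf (Finₚ.toℕ-injective (trans e₂ (≡.sym e₃))))

    packed : ∀ {u v} → View u → View v → u ≢ x → v ≢ x → u ≢ v → cn u ≡ cn v → 0 < cn u → DistGt G u v s
    packed (spineᵛ i) (spineᵛ i′) _ _ u≢v e ci>0 = ⊥-elim (u≢v (cong spine (Finₚ.toℕ-injective
      (trans (≡.sym (proj₁ (spine-later i ci>0))) (trans e (proj₁ (spine-later i′ (subst (0 <_) e ci>0))))))))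
    packed (spineᵛ i) (leafᵛ j) _ _ _ e ci>0 =
      ⊥-elim (proj₂ (spine-later i ci>0) (trans (≡.sym (proj₁ (spine-later i ci>0))) (trans e (proj₁ (leaf-later j (subst (0 <_) e ci>0))))))
    packed (leafᵛ j) (spineᵛ i) _ _ _ e cj>0 = ⊥-elim (proj₂ (spine-later i ci>0)
      (trans (≡.sym (proj₁ (spine-later i ci>0))) (trans (≡.sym e) (proj₁ (leaf-later j cj>0)))))
      where ci>0 = subst (0 <_) e cj>0
    packed (leafᵛ j) (leafᵛ j′) j≢x j′≢x u≢v e cj>0
      with proj₂ (leaf-later j cj>0) | proj₂ (leaf-later j′ (subst (0 <_) e cj>0))
    ... | inj₁ j≡0  | inj₁ j′≡0 = ⊥-elim (u≢v (cong leaf (Finₚ.toℕ-injective (trans j≡0 (≡.sym j′≡0)))))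
    ... | inj₁ j≡0  | inj₂ j′≥  = leaf₀-far j j′ j≡0 j′≥
    ... | inj₂ j≥   | inj₁ j′≡0 = DistGt-sym (leaf₀-far j′ j j′≡0 j≥)
    ... | inj₂ j≥   | inj₂ j′≥  = ⊥-elim (right-leaves-unique j j′ (u≢v ∘ cong leaf) j≢x j′≢x j≥ j′≥)

    colorable-without : PackingColorable S (delete G x) (3 + r)
    colorable-without = colorable-delete cn (3 + r) x (ℕₚ.n≤1+n _) (bounded ∘ view)
                          (λ u v → independent (view u) (view v)) (λ u v → packed (view u) (view v))

  leaf-deletion : ∀ j → PackingColorable S (delete G (leaf j)) (3 + r)
  leaf-deletion jx with toℕ jx ℕ.≤? 1 + r
  ... | no jx>1+r = RightLeafDeletion.colorable-without jx (ℕₚ.≰⇒> jx>1+r)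
  ... | yes jx≤1+r = squeezed-colorable p (leaf jx) only-jx (ℕₚ.n≤1+n _)
    where
    p : Fin (3 + r)
    p = fromℕ< (s≤s (ℕₚ.≤-trans jx≤1+r (ℕₚ.n≤1+n _)))
    only-jx : ∀ j → anchor j ≡ toℕ p → leaf jx ≡ leaf j ⊎ leaf jx ≡ spine p
    only-jx j e with ℕₚ.≤-total (toℕ j) (2 + r)
    ... | inj₁ j≤ = inj₁ (cong leaf (Finₚ.toℕ-injective (≡.sym (trans (≡.sym (anchor-left j j≤)) (trans e (Finₚ.toℕ-fromℕ< _))))))
    ... | inj₂ j≥ = ⊥-elim (ℕₚ.<⇒≢ (s≤s jx≤1+r) (≡.sym (trans (≡.sym (anchor-right j j≥)) (trans e (Finₚ.toℕ-fromℕ< _)))))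

  critical-s+1 : Critical S G (4 + r)
  critical-s+1 = critical ℕₚ.≤-refl needs-s+1 leaf-deletion

-- The position of a among {0, 1, 2} ∖ {b}.
rankExcept : ℕ → ℕ → ℕ
rankExcept 0             a       = ℕ.pred a
rankExcept 1             0       = 0
rankExcept 1             (suc a) = a
rankExcept (suc (suc b)) a       = a ⊓ 1

rankExcept≤1 : ∀ b a → a ≤ 2 → rankExcept b a ≤ 1
rankExcept≤1 0             0       _           = z≤n
rankExcept≤1 0             (suc a) (s≤s a≤1)   = a≤1
rankExcept≤1 1             0       _           = z≤n
rankExcept≤1 1             (suc a) (s≤s a≤1)   = a≤1
rankExcept≤1 (suc (suc b)) a       _           = ℕₚ.m⊓n≤n a 1

rankExcept-injective : ∀ b a a′ → b ≤ 2 → a ≤ 2 → a′ ≤ 2 → a ≢ b → a′ ≢ b → rankExcept b a ≡ rankExcept b a′ → a ≡ a′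
rankExcept-injective 0 0       _        _ _ _ a≢0 _    _ = ⊥-elim (a≢0 refl)
rankExcept-injective 0 (suc a) 0        _ _ _ _   a′≢0 _ = ⊥-elim (a′≢0 refl)
rankExcept-injective 0 (suc a) (suc a′) _ _ _ _   _    e = cong suc e
rankExcept-injective 1 0       0        _ _ _ _   _    _ = refl
rankExcept-injective 1 0       (suc a′) _ _ _ _   a′≢1 e = ⊥-elim (a′≢1 (cong suc (≡.sym e)))
rankExcept-injective 1 (suc a) 0        _ _ _ a≢1 _    e = ⊥-elim (a≢1 (cong suc e))
rankExcept-injective 1 (suc a) (suc a′) _ _ _ _   _    e = cong suc e
rankExcept-injective 2 a a′ _ a≤2 a′≤2 a≢2 a′≢2 e =
  trans (≡.sym (ℕₚ.m≤n⇒m⊓n≡m (≤1 a≤2 a≢2))) (trans e (ℕₚ.m≤n⇒m⊓n≡m (≤1 a′≤2 a′≢2)))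
  where
  ≤1 : ∀ {x} → x ≤ 2 → x ≢ 2 → x ≤ 1
  ≤1 x≤2 x≢2 = ℕₚ.≤-pred (ℕₚ.≤∧≢⇒< x≤2 x≢2)
rankExcept-injective (suc (suc (suc b))) _ _ (s≤s (s≤s ())) _ _ _ _ _

-- The caterpillar with spine 0 … s (s = r + 3), three leaves on each end vertex and one leaf on every inner
-- spine vertex.  Depending on which end vertices have color 1, a window of s + 1 consecutive columns
-- contains s + 1 vertices avoiding color 1 and pairwise at distance at most s.
module CriticalS+2 (r : ℕ) where
  s : ℕ
  s = 3 + r
  open Coloring (3 + r) (8 + r) 2 (4 + r) s public

  anchor-left : ∀ {y} → y ≤ 2 → (y ∸ 2) ⊓ (3 + r) ≡ 0
  anchor-left y≤2 = cong (_⊓ (3 + r)) (ℕₚ.m≤n⇒m∸n≡0 y≤2)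

  anchor-right : ∀ (j : Fin (8 + r)) → 5 + r ≤ toℕ j → anchor j ≡ 3 + r
  anchor-right j j≥ = ℕₚ.m≥n⇒m⊓n≡n (ℕₚ.∸-monoˡ-≤ 2 j≥)

  isCaterpillar : IsCaterpillar G
  isCaterpillar = SpineOfNonLeaves.isCaterpillar (s≤s z≤n) Fin.zero refl (Fin.fromℕ (7 + r))
    (anchor-right (Fin.fromℕ (7 + r)) (ℕₚ.≤-trans (ℕₚ.n≤1+n _) (ℕₚ.≤-trans (ℕₚ.n≤1+n _) (ℕₚ.≤-reflexive (≡.sym (Finₚ.toℕ-fromℕ (7 + r)))))))

  first-end last-end : V
  first-end = spineAt 0 (s≤s z≤n)
  last-end  = spineAt (3 + r) ℕₚ.≤-refl

  module _ {j c} (coloring : IsPackingColoring S G j c) where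
    open NonFirst coloring

    a<8+r : ∀ (a : Fin (4 + r)) → toℕ a < 8 + r
    a<8+r a = ℕₚ.≤-trans (Finₚ.toℕ<n a) (ℕₚ.m≤n+m (4 + r) 4)

    first-end-first : toℕ (c first-end) ≡ 0 → 5 + r ≤ j
    first-end-first first = window-clique {0} {0} {2 + r} {1} (3 + r) cand (ℕₚ.≤-reflexive (ℕₚ.+-comm (2 + r) 1))
      where
      cand : ∀ (a : Fin (4 + r)) → Candidate 0 0 (2 + r) 1 (toℕ a)
      cand a with toℕ a ℕ.≤? 2
      ... | yes a≤2 = candidate-leaf (toℕ a) (a<8+r a) 0 (anchor-left a≤2) refl
                        (SeqSPacking.color₁-neighbor coloring (spine-leaf-adj 0 (toℕ a) (s≤s z≤n) (a<8+r a) (anchor-left a≤2)) first)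
                        ℕₚ.≤-refl (s≤s z≤n)
      ... | no a>2 = candidate-pick (toℕ a ∸ 2) column< key< key≡ (ℕₚ.m≤n+m 1 (toℕ a ∸ 2)) ≤hi
        where
        a≥2 = ℕₚ.≤-trans (ℕₚ.n≤1+n 2) (ℕₚ.≰⇒> a>2)
        key≡ : toℕ a ∸ 2 + 2 ≡ 0 + toℕ a
        key≡ = ℕₚ.m∸n+n≡m a≥2
        column< : toℕ a ∸ 2 < 4 + r
        column< = ℕₚ.≤-trans (s≤s (ℕₚ.m∸n≤m (toℕ a) 2)) (Finₚ.toℕ<n a)
        key< : toℕ a ∸ 2 + 2 < 8 + r
        key< = subst (_< 8 + r) (≡.sym key≡) (a<8+r a)
        ≤hi : toℕ a ∸ 2 + 1 ≤ 2 + r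
        ≤hi = ℕₚ.≤-trans (ℕₚ.≤-reflexive (ℕₚ.+-comm (toℕ a ∸ 2) 1)) (ℕₚ.∸-monoˡ-< (Finₚ.toℕ<n a) a≥2)

    last-end-first : toℕ (c last-end) ≡ 0 → 5 + r ≤ j
    last-end-first last = window-clique {4} {2} {4 + r} {1} (3 + r) cand (ℕₚ.≤-reflexive (ℕₚ.+-comm (4 + r) 1))
      where
      cand : ∀ (a : Fin (4 + r)) → Candidate 4 2 (4 + r) 1 (toℕ a)
      cand a with toℕ a ℕ.≤? r
      ... | yes a≤r = candidate-pick (2 + toℕ a) (s≤s (s≤s (s≤s (ℕₚ.≤-trans a≤r (ℕₚ.n≤1+n r)))))
                        (subst (_< 8 + r) (≡.sym key≡) (s≤s (s≤s (s≤s (s≤s (Finₚ.toℕ<n a)))))) key≡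
                        (s≤s (s≤s (ℕₚ.m≤n+m 1 (toℕ a))))
                        (s≤s (s≤s (ℕₚ.≤-trans (ℕₚ.≤-reflexive (ℕₚ.+-comm (toℕ a) 1)) (s≤s (ℕₚ.≤-trans a≤r (ℕₚ.n≤1+n r))))))
        where
        key≡ : 2 + toℕ a + 2 ≡ 4 + toℕ a
        key≡ = cong (2 +_) (ℕₚ.+-comm (toℕ a) 2)
      ... | no a>r = candidate-leaf (4 + toℕ a) key< (3 + r) anchor≡ refl
                       (SeqSPacking.color₁-neighbor coloring (spine-leaf-adj (3 + r) (4 + toℕ a) ℕₚ.≤-refl key< anchor≡) last)
                       (s≤s (s≤s (s≤s z≤n))) (ℕₚ.≤-reflexive (ℕₚ.+-comm (3 + r) 1))
        where
        key< : 4 + toℕ a < 8 + r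
        key< = s≤s (s≤s (s≤s (s≤s (Finₚ.toℕ<n a))))
        anchor≡ : (4 + toℕ a ∸ 2) ⊓ (3 + r) ≡ 3 + r
        anchor≡ = ℕₚ.m≥n⇒m⊓n≡n (s≤s (s≤s (ℕₚ.≰⇒> a>r)))

    no-end-first : 0 < toℕ (c first-end) → 0 < toℕ (c last-end) → 5 + r ≤ j
    no-end-first first-nonfirst last-nonfirst = window-clique {2} {0} {3 + r} {0} (3 + r) cand (ℕₚ.≤-reflexive (ℕₚ.+-identityʳ _))
      where
      cand : ∀ (a : Fin (4 + r)) → Candidate 2 0 (3 + r) 0 (toℕ a)
      cand a with toℕ a ℕ.≟ 0 | toℕ a ℕ.≤? 2 + r
      ... | yes a≡0 | _ = candidate-spine 0 (s≤s z≤n) (cong (2 +_) (≡.sym a≡0)) first-nonfirst z≤n z≤n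
      ... | no a≢0 | yes a≤2+r = candidate-pick (toℕ a) (Finₚ.toℕ<n a) key< (ℕₚ.+-comm (toℕ a) 2)
                                   (subst (1 ≤_) (≡.sym (ℕₚ.+-identityʳ (toℕ a))) (ℕₚ.n≢0⇒n>0 a≢0))
                                   (subst (_≤ 3 + r) (ℕₚ.+-comm 1 (toℕ a)) (s≤s a≤2+r))
        where
        key< : toℕ a + 2 < 8 + r
        key< = subst (_< 8 + r) (ℕₚ.+-comm 2 (toℕ a)) (s≤s (s≤s (ℕₚ.≤-trans (Finₚ.toℕ<n a) (ℕₚ.m≤n+m (4 + r) 2))))
      ... | no _ | no a>2+r = candidate-spine (3 + r) ℕₚ.≤-refl key≡ last-nonfirst z≤n (ℕₚ.≤-reflexive (ℕₚ.+-identityʳ _))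
        where
        key≡ : 3 + r + 2 ≡ 2 + toℕ a
        key≡ = trans (ℕₚ.+-comm (3 + r) 2) (cong (2 +_) (ℕₚ.≤-antisym (ℕₚ.≰⇒> a>2+r) (ℕₚ.≤-pred (Finₚ.toℕ<n a))))

  needs-s+2 : ∀ j → j < 5 + r → ¬ PackingColorable S G j
  needs-s+2 j j<s+2 (_ , c , coloring) with toℕ (c first-end) ℕ.≟ 0 | toℕ (c last-end) ℕ.≟ 0
  ... | yes first | _        = ℕₚ.<⇒≱ j<s+2 (first-end-first coloring first)
  ... | no _      | yes last = ℕₚ.<⇒≱ j<s+2 (last-end-first coloring last)
  ... | no first  | no last  = ℕₚ.<⇒≱ j<s+2 (no-end-first coloring (ℕₚ.n≢0⇒n>0 first) (ℕₚ.n≢0⇒n>0 last))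


  ⊓-cases : ∀ a b → (a ≤ b × a ⊓ b ≡ a) ⊎ (b ≤ a × a ⊓ b ≡ b)
  ⊓-cases a b with ℕₚ.≤-total a b
  ... | inj₁ a≤b = inj₁ (a≤b , ℕₚ.m≤n⇒m⊓n≡m a≤b)
  ... | inj₂ b≤a = inj₂ (b≤a , ℕₚ.m≥n⇒m⊓n≡n b≤a)

  -- Color 1 on spine 0 and spine s − 1, colors 2 … s − 1 on spine 1 … s − 2, the remaining two left leaves
  -- on colors s and s + 1, shared with spine s and the leaf of spine s − 1 respectively.
  module LeftLeafDeletion (jd : Fin (8 + r)) (jd≤2 : toℕ jd ≤ 2) where
    x = leaf jd
    b = toℕ jd

    data SpineCase (i : ℕ) : ℕ → Set where
      end₀  : i ≡ 0 → SpineCase i 0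
      gap   : i ≡ 2 + r → SpineCase i 0
      end₁  : i ≡ 3 + r → SpineCase i (2 + r)
      inner : i ≢ 0 → i ≢ 2 + r → i ≢ 3 + r → SpineCase i i

    spine-case : ∀ i → Σ ℕ (SpineCase i)
    spine-case i with i ℕ.≟ 0 | i ℕ.≟ 2 + r | i ℕ.≟ 3 + r
    ... | yes i≡0 | _       | _       = _ , end₀ i≡0
    ... | no _    | yes i≡  | _       = _ , gap i≡
    ... | no _    | no _    | yes i≡  = _ , end₁ i≡
    ... | no i≢0  | no i≢   | no i≢′  = _ , inner i≢0 i≢ i≢′

    data LeafCase (j : ℕ) : ℕ → Set where
      paired : j ≤ 2 → LeafCase j (2 + r + rankExcept b j)
      z-leaf : j ≡ 4 + r → LeafCase j (3 + r)
      other  : ¬ j ≤ 2 → j ≢ 4 + r → LeafCase j 0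

    leaf-case : ∀ j → Σ ℕ (LeafCase j)
    leaf-case j with j ℕ.≤? 2 | j ℕ.≟ 4 + r
    ... | yes j≤2 | _       = _ , paired j≤2
    ... | no j>2  | yes j≡  = _ , z-leaf j≡
    ... | no j>2  | no j≢   = _ , other j>2 j≢

    cn : V → ℕ
    cn = byKind (λ i → proj₁ (spine-case (toℕ i))) (λ j → proj₁ (leaf-case (toℕ j)))

    bounded′ : ∀ {v} → View v → cn v < 4 + r
    bounded′ (spineᵛ i) rewrite byKind-spine (λ i → proj₁ (spine-case (toℕ i))) (λ j → proj₁ (leaf-case (toℕ j))) i
      with spine-case (toℕ i)
    ... | _ , end₀ _        = s≤s z≤n
    ... | _ , gap _         = s≤s z≤n
    ... | _ , end₁ _        = ℕₚ.n≤1+n _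
    ... | _ , inner _ _ _   = Finₚ.toℕ<n i
    bounded′ (leafᵛ j) rewrite byKind-leaf (λ i → proj₁ (spine-case (toℕ i))) (λ j → proj₁ (leaf-case (toℕ j))) j
      with leaf-case (toℕ j)
    ... | _ , paired j≤2    = ℕₚ.≤-trans (s≤s (ℕₚ.+-monoʳ-≤ (2 + r) (rankExcept≤1 b (toℕ j) j≤2)))
                                       (ℕₚ.≤-reflexive (cong suc (ℕₚ.+-comm (2 + r) 1)))
    ... | _ , z-leaf _      = ℕₚ.≤-refl
    ... | _ , other _ _     = s≤s z≤n

    A : ℕ → Set
    A p = p ≡ 0 ⊎ p ≡ 2 + r

    A-apart : ∀ p q → A p → A q → q ≢ suc p
    A-apart p q (inj₁ refl) (inj₁ refl) ()
    A-apart p q (inj₁ refl) (inj₂ refl) e = ℕₚ.1+n≢0 (ℕₚ.suc-injective e)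
    A-apart p q (inj₂ refl) (inj₁ refl) ()
    A-apart p q (inj₂ refl) (inj₂ refl) e = ℕₚ.1+n≢n (≡.sym e)

    z₀<8+r : 4 + r < 8 + r
    z₀<8+r = s≤s (s≤s (s≤s (s≤s (s≤s (ℕₚ.m≤n+m r 3)))))

    z₀ : Fin (8 + r)
    z₀ = fromℕ< z₀<8+r

    Paired : Fin (8 + r) → Set
    Paired j = toℕ j ≤ 2

    rank : Fin (8 + r) → ℕ
    rank j = rankExcept b (toℕ j)

    rank-injective : ∀ j j′ → Paired j → Paired j′ → leaf j ≢ x → leaf j′ ≢ x → rank j ≡ rank j′ → j ≡ j′
    rank-injective j j′ pj pj′ j≢ j′≢ e =
      Finₚ.toℕ-injective (rankExcept-injective b (toℕ j) (toℕ j′) jd≤2 pj pj′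
        (j≢ ∘ cong leaf ∘ Finₚ.toℕ-injective) (j′≢ ∘ cong leaf ∘ Finₚ.toℕ-injective) e)

    Y-far : ∀ i j → toℕ i ≡ 3 + r → Paired j → DistGt G (spine i) (leaf j) s
    Y-far i j i≡ pj = far⇒DistGt′ (spine i) (leaf j) (spine≢leaf i j) far
      where
      far : s + column (leaf j) < column (spine i) + (row (spine i) + row (leaf j))
      far rewrite trans (column-leaf j) (anchor-left pj) | trans (column-spine i) i≡ | row-spine i | row-leaf j | ℕₚ.+-identityʳ (3 + r) =
        ℕₚ.≤-reflexive (ℕₚ.+-comm 1 (3 + r))

    Z-far : ∀ j → Paired j → DistGt G (leaf z₀) (leaf j) s
    Z-far j pj = far⇒DistGt′ (leaf z₀) (leaf j) z₀≢j far
      where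
      z₀≢j : leaf z₀ ≢ leaf j
      z₀≢j e = ℕₚ.<⇒≢ (s≤s (ℕₚ.≤-trans pj (ℕₚ.≤-trans (ℕₚ.n≤1+n 2) (ℕₚ.m≤m+n 3 r))))
                       (trans (≡.sym (cong toℕ (leaf-injective e))) (Finₚ.toℕ-fromℕ< z₀<8+r))
      anchor-z₀ : anchor z₀ ≡ 2 + r
      anchor-z₀ = trans (cong (λ z → (z ∸ 2) ⊓ (3 + r)) (Finₚ.toℕ-fromℕ< z₀<8+r)) (ℕₚ.m≤n⇒m⊓n≡m (ℕₚ.n≤1+n _))
      far : s + column (leaf j) < column (leaf z₀) + (row (leaf z₀) + row (leaf j))
      far rewrite trans (column-leaf j) (anchor-left pj) | trans (column-leaf z₀) anchor-z₀ | row-leaf j | row-leaf z₀ | ℕₚ.+-identityʳ (3 + r) =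
        ℕₚ.≤-reflexive (≡.sym (ℕₚ.+-comm (2 + r) 2))

    open ClassCertificate cn x A A-apart 0 (1 + r) (2 + r) (3 + r) ℕₚ.≤-refl ℕₚ.≤-refl (3 + r) Paired rank z₀ rank-injective Y-far Z-far

    other⇒¬A : ∀ j → ¬ toℕ j ≤ 2 → toℕ j ≢ 4 + r → ¬ A (anchor j)
    other⇒¬A j j>2 j≢ a with ⊓-cases (toℕ j ∸ 2) (3 + r)
    ... | inj₁ (_ , e) = [ (λ h → j>2 (ℕₚ.m∸n≡0⇒m≤n (trans (≡.sym e) h)))
                         , (λ h → j≢ (trans (≡.sym (ℕₚ.m∸n+n≡m (ℕₚ.≤-trans (ℕₚ.n≤1+n 2) (ℕₚ.≰⇒> j>2))))
                                            (trans (cong (_+ 2) (trans (≡.sym e) h)) (ℕₚ.+-comm (2 + r) 2)))) ]′ a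
    ... | inj₂ (_ , e) = [ (λ h → ℕₚ.1+n≢0 (trans (≡.sym e) h)) , (λ h → ℕₚ.1+n≢n (trans (≡.sym e) h)) ]′ a

    classify-paired : ∀ j → Paired j → cn (leaf j) ≡ 2 + r + rank j → Class (leaf j)
    classify-paired j pj cn≡ with rank j in rank≡ | rankExcept≤1 b (toℕ j) pj
    ... | 0 | _ = Y-leaf j refl pj rank≡ (trans cn≡ (ℕₚ.+-identityʳ _))
    ... | 1 | _ = Z-leaf j refl pj rank≡ (trans cn≡ (ℕₚ.+-comm (2 + r) 1))
    ... | suc (suc _) | s≤s ()

    classify′ : ∀ {v} → View v → v ≢ x → Class v
    classify′ (spineᵛ i) _ with spine-case (toℕ i) in eq
    ... | _ , end₀ i≡0  = first (trans (byKind-spine _ _ i) (cong proj₁ eq)) (inj₁ (row-spine i , inj₁ (trans (column-spine i) i≡0)))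
    ... | _ , gap i≡    = first (trans (byKind-spine _ _ i) (cong proj₁ eq)) (inj₁ (row-spine i , inj₂ (trans (column-spine i) i≡)))
    ... | _ , end₁ i≡   = Y-spine i refl i≡ (trans (byKind-spine _ _ i) (cong proj₁ eq))
    ... | _ , inner i≢0 i≢ i≢′ = shifted i refl (trans (byKind-spine _ _ i) (cong proj₁ eq)) (ℕₚ.n≢0⇒n>0 i≢0)
      (ℕₚ.≤-trans (ℕₚ.≤-reflexive (trans (byKind-spine _ _ i) (cong proj₁ eq)))
                  (ℕₚ.≤-pred (ℕₚ.≤∧≢⇒< (ℕₚ.≤-pred (ℕₚ.≤∧≢⇒< (ℕₚ.≤-pred (Finₚ.toℕ<n i)) i≢′)) i≢)))
    classify′ (leafᵛ j) _ with leaf-case (toℕ j) in eq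
    ... | _ , paired j≤2 = classify-paired j j≤2 (trans (byKind-leaf _ _ j) (cong proj₁ eq))
    ... | _ , z-leaf j≡ =
      Z-leaf₀ (cong leaf (Finₚ.toℕ-injective (trans j≡ (≡.sym (Finₚ.toℕ-fromℕ< z₀<8+r))))) (trans (byKind-leaf _ _ j) (cong proj₁ eq))
    ... | _ , other j>2 j≢ =
      first (trans (byKind-leaf _ _ j) (cong proj₁ eq))
            (inj₂ (row-leaf j , subst (¬_ ∘ A) (≡.sym (column-leaf j)) (other⇒¬A j j>2 j≢)))

    colorable-without : PackingColorable S (delete G x) (4 + r)
    colorable-without = colorable-delete cn (4 + r) x (ℕₚ.n≤1+n _) (bounded′ ∘ view)
                          (Certified.independent (λ v → classify′ (view v))) (Certified.packed (λ v → classify′ (view v)))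

  -- The mirror image: color 1 on spine 1 and spine s, colors 2 … s − 1 on spine 2 … s − 1, the remaining two
  -- right leaves on colors s and s + 1, shared with spine 0 and the leaf of spine 1 respectively.
  module RightLeafDeletion (jd : Fin (8 + r)) (jd≥5+r : 5 + r ≤ toℕ jd) where
    x = leaf jd

    offset : ℕ → ℕ
    offset j = j ∸ (5 + r)

    offset≤2 : ∀ (j : Fin (8 + r)) → offset (toℕ j) ≤ 2
    offset≤2 j = ℕₚ.m≤n+o⇒m∸n≤o (toℕ j) (5 + r) (ℕₚ.≤-trans (ℕₚ.≤-pred (Finₚ.toℕ<n j)) (ℕₚ.≤-reflexive (≡.sym (ℕₚ.+-comm (5 + r) 2))))

    b = offset (toℕ jd)

    data SpineCase (i : ℕ) : ℕ → Set where
      second : i ≡ 1 → SpineCase i 0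
      end₁   : i ≡ 3 + r → SpineCase i 0
      end₀   : i ≡ 0 → SpineCase i (2 + r)
      inner  : i ≢ 1 → i ≢ 3 + r → i ≢ 0 → SpineCase i (i ∸ 1)

    spine-case : ∀ i → Σ ℕ (SpineCase i)
    spine-case i with i ℕ.≟ 1 | i ℕ.≟ 3 + r | i ℕ.≟ 0
    ... | yes i≡1 | _      | _      = _ , second i≡1
    ... | no _    | yes i≡ | _      = _ , end₁ i≡
    ... | no _    | no _   | yes i≡ = _ , end₀ i≡
    ... | no i≢1  | no i≢  | no i≢0 = _ , inner i≢1 i≢ i≢0

    data LeafCase (j : ℕ) : ℕ → Set where
      paired : 5 + r ≤ j → LeafCase j (2 + r + rankExcept b (offset j))
      z-leaf : j ≡ 3 → LeafCase j (3 + r)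
      other  : ¬ 5 + r ≤ j → j ≢ 3 → LeafCase j 0

    leaf-case : ∀ j → Σ ℕ (LeafCase j)
    leaf-case j with 5 + r ℕ.≤? j | j ℕ.≟ 3
    ... | yes j≥ | _      = _ , paired j≥
    ... | no j<  | yes j≡ = _ , z-leaf j≡
    ... | no j<  | no j≢  = _ , other j< j≢

    cn : V → ℕ
    cn = byKind (λ i → proj₁ (spine-case (toℕ i))) (λ j → proj₁ (leaf-case (toℕ j)))

    bounded′ : ∀ {v} → View v → cn v < 4 + r
    bounded′ (spineᵛ i) rewrite byKind-spine (λ i → proj₁ (spine-case (toℕ i))) (λ j → proj₁ (leaf-case (toℕ j))) i
      with spine-case (toℕ i)
    ... | _ , second _    = s≤s z≤n
    ... | _ , end₁ _      = s≤s z≤n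
    ... | _ , end₀ _      = ℕₚ.n≤1+n _
    ... | _ , inner _ _ _ = ℕₚ.≤-<-trans (ℕₚ.m∸n≤m (toℕ i) 1) (Finₚ.toℕ<n i)
    bounded′ (leafᵛ j) rewrite byKind-leaf (λ i → proj₁ (spine-case (toℕ i))) (λ j → proj₁ (leaf-case (toℕ j))) j
      with leaf-case (toℕ j)
    ... | _ , paired _  = ℕₚ.≤-trans (s≤s (ℕₚ.+-monoʳ-≤ (2 + r) (rankExcept≤1 b (offset (toℕ j)) (offset≤2 j))))
                                     (ℕₚ.≤-reflexive (cong suc (ℕₚ.+-comm (2 + r) 1)))
    ... | _ , z-leaf _  = ℕₚ.≤-refl
    ... | _ , other _ _ = s≤s z≤n

    A : ℕ → Set
    A p = p ≡ 1 ⊎ p ≡ 3 + r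

    A-apart : ∀ p q → A p → A q → q ≢ suc p
    A-apart p q (inj₁ refl) (inj₁ refl) ()
    A-apart p q (inj₁ refl) (inj₂ refl) e = ℕₚ.1+n≢0 (ℕₚ.suc-injective (ℕₚ.suc-injective e))
    A-apart p q (inj₂ refl) (inj₁ refl) ()
    A-apart p q (inj₂ refl) (inj₂ refl) e = ℕₚ.1+n≢n (≡.sym e)

    z₀<8+r : 3 < 8 + r
    z₀<8+r = s≤s (s≤s (s≤s (s≤s z≤n)))

    z₀ : Fin (8 + r)
    z₀ = fromℕ< z₀<8+r

    Paired : Fin (8 + r) → Set
    Paired j = 5 + r ≤ toℕ j

    rank : Fin (8 + r) → ℕ
    rank j = rankExcept b (offset (toℕ j))

    offset-injective : ∀ {a a′} → 5 + r ≤ a → 5 + r ≤ a′ → offset a ≡ offset a′ → a ≡ a′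
    offset-injective a≥ a′≥ e = trans (≡.sym (ℕₚ.m∸n+n≡m a≥)) (trans (cong (_+ (5 + r)) e) (ℕₚ.m∸n+n≡m a′≥))

    rank-injective : ∀ j j′ → Paired j → Paired j′ → leaf j ≢ x → leaf j′ ≢ x → rank j ≡ rank j′ → j ≡ j′
    rank-injective j j′ pj pj′ j≢ j′≢ e = Finₚ.toℕ-injective (offset-injective pj pj′
      (rankExcept-injective b _ _ (offset≤2 jd) (offset≤2 j) (offset≤2 j′) (other-offset j pj j≢) (other-offset j′ pj′ j′≢) e))
      where
      other-offset : ∀ j → Paired j → leaf j ≢ x → offset (toℕ j) ≢ b
      other-offset j pj j≢ e = j≢ (cong leaf (Finₚ.toℕ-injective (offset-injective pj jd≥5+r e)))

    Y-far : ∀ i j → toℕ i ≡ 0 → Paired j → DistGt G (spine i) (leaf j) s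
    Y-far i j i≡0 pj = far⇒DistGt (spine i) (leaf j) (spine≢leaf i j) far
      where
      far : s + column (spine i) < column (leaf j) + (row (spine i) + row (leaf j))
      far rewrite trans (column-leaf j) (anchor-right j pj) | trans (column-spine i) i≡0 | row-spine i | row-leaf j | ℕₚ.+-identityʳ (3 + r) =
        ℕₚ.≤-reflexive (ℕₚ.+-comm 1 (3 + r))

    Z-far : ∀ j → Paired j → DistGt G (leaf z₀) (leaf j) s
    Z-far j pj = far⇒DistGt (leaf z₀) (leaf j) z₀≢j far
      where
      z₀≢j : leaf z₀ ≢ leaf j
      z₀≢j e = ℕₚ.<⇒≢ (ℕₚ.≤-trans (s≤s (s≤s (s≤s (s≤s z≤n)))) pj) (trans (≡.sym (Finₚ.toℕ-fromℕ< z₀<8+r)) (cong toℕ (leaf-injective e)))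
      anchor-z₀ : anchor z₀ ≡ 1
      anchor-z₀ = cong (λ z → (z ∸ 2) ⊓ (3 + r)) (Finₚ.toℕ-fromℕ< z₀<8+r)
      far : s + column (leaf z₀) < column (leaf j) + (row (leaf z₀) + row (leaf j))
      far rewrite trans (column-leaf j) (anchor-right j pj) | trans (column-leaf z₀) anchor-z₀ | row-leaf j | row-leaf z₀ =
        ℕₚ.≤-reflexive (trans (cong suc (ℕₚ.+-comm (3 + r) 1)) (≡.sym (ℕₚ.+-comm (3 + r) 2)))

    open ClassCertificate cn x A A-apart 1 (1 + r) (2 + r) (3 + r) ℕₚ.≤-refl ℕₚ.≤-refl 0 Paired rank z₀ rank-injective Y-far Z-far

    ∸2≡1 : ∀ n → n ∸ 2 ≡ 1 → n ≡ 3
    ∸2≡1 (suc (suc n)) h = cong (λ z → suc (suc z)) h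

    ∸2≥ : ∀ n → 3 + r ≤ n ∸ 2 → 5 + r ≤ n
    ∸2≥ (suc (suc n)) h = s≤s (s≤s h)

    other⇒¬A : ∀ j → ¬ 5 + r ≤ toℕ j → toℕ j ≢ 3 → ¬ A (anchor j)
    other⇒¬A j j< j≢3 a with ⊓-cases (toℕ j ∸ 2) (3 + r)
    ... | inj₁ (_ , e) = [ (λ h → j≢3 (∸2≡1 (toℕ j) (trans (≡.sym e) h)))
                         , (λ h → j< (∸2≥ (toℕ j) (ℕₚ.≤-reflexive (≡.sym (trans (≡.sym e) h))))) ]′ a
    ... | inj₂ (ge , e) = [ (λ h → ℕₚ.1+n≢0 (ℕₚ.suc-injective (trans (≡.sym e) h))) , (λ _ → j< (∸2≥ (toℕ j) ge)) ]′ a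

    classify-paired : ∀ j → Paired j → cn (leaf j) ≡ 2 + r + rank j → Class (leaf j)
    classify-paired j pj cn≡ with rank j in rank≡ | rankExcept≤1 b (offset (toℕ j)) (offset≤2 j)
    ... | 0 | _ = Y-leaf j refl pj rank≡ (trans cn≡ (ℕₚ.+-identityʳ _))
    ... | 1 | _ = Z-leaf j refl pj rank≡ (trans cn≡ (ℕₚ.+-comm (2 + r) 1))
    ... | suc (suc _) | s≤s ()

    classify′ : ∀ {v} → View v → v ≢ x → Class v
    classify′ (spineᵛ i) _ with spine-case (toℕ i) in eq
    ... | _ , second i≡1 = first (trans (byKind-spine _ _ i) (cong proj₁ eq)) (inj₁ (row-spine i , inj₁ (trans (column-spine i) i≡1)))
    ... | _ , end₁ i≡    = first (trans (byKind-spine _ _ i) (cong proj₁ eq)) (inj₁ (row-spine i , inj₂ (trans (column-spine i) i≡)))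
    ... | _ , end₀ i≡0   = Y-spine i refl i≡0 (trans (byKind-spine _ _ i) (cong proj₁ eq))
    ... | _ , inner i≢1 i≢ i≢0 = shifted i refl (trans (byKind-spine _ _ i) (cong proj₁ eq)) (ℕₚ.≤∧≢⇒< (ℕₚ.n≢0⇒n>0 i≢0) (i≢1 ∘ ≡.sym))
      (ℕₚ.≤-trans (ℕₚ.≤-reflexive (trans (byKind-spine _ _ i) (cong proj₁ eq)))
                  (ℕₚ.∸-monoˡ-≤ 1 (ℕₚ.≤-pred (ℕₚ.≤∧≢⇒< (ℕₚ.≤-pred (Finₚ.toℕ<n i)) i≢))))
    classify′ (leafᵛ j) _ with leaf-case (toℕ j) in eq
    ... | _ , paired j≥ = classify-paired j j≥ (trans (byKind-leaf _ _ j) (cong proj₁ eq))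
    ... | _ , z-leaf j≡ =
      Z-leaf₀ (cong leaf (Finₚ.toℕ-injective (trans j≡ (≡.sym (Finₚ.toℕ-fromℕ< z₀<8+r))))) (trans (byKind-leaf _ _ j) (cong proj₁ eq))
    ... | _ , other j< j≢ =
      first (trans (byKind-leaf _ _ j) (cong proj₁ eq)) (inj₂ (row-leaf j , subst (¬_ ∘ A) (≡.sym (column-leaf j)) (other⇒¬A j j< j≢)))

    colorable-without : PackingColorable S (delete G x) (4 + r)
    colorable-without = colorable-delete cn (4 + r) x (ℕₚ.n≤1+n _) (bounded′ ∘ view)
                          (Certified.independent (λ v → classify′ (view v))) (Certified.packed (λ v → classify′ (view v)))

  leaf-deletion : ∀ j → PackingColorable S (delete G (leaf j)) (4 + r)
  leaf-deletion jx with toℕ jx ℕ.≤? 2 | 5 + r ℕ.≤? toℕ jx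
  ... | yes jx≤2 | _       = LeftLeafDeletion.colorable-without jx jx≤2
  ... | no _     | yes jx≥ = RightLeafDeletion.colorable-without jx jx≥
  ... | no jx>2  | no jx<  = squeezed-colorable p (leaf jx) only-jx (ℕₚ.n≤1+n _)
    where
    jx≥2 : 2 ≤ toℕ jx
    jx≥2 = ℕₚ.≤-trans (ℕₚ.n≤1+n 2) (ℕₚ.≰⇒> jx>2)
    column< : toℕ jx ∸ 2 < 3 + r
    column< = ℕₚ.∸-monoˡ-< (ℕₚ.≰⇒> jx<) jx≥2
    p : Fin (4 + r)
    p = fromℕ< (ℕₚ.≤-trans column< (ℕₚ.n≤1+n _))
    only-jx : ∀ j → anchor j ≡ toℕ p → leaf jx ≡ leaf j ⊎ leaf jx ≡ spine p
    only-jx j e with ⊓-cases (toℕ j ∸ 2) (3 + r)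
    ... | inj₁ (_ , e′) = inj₁ (cong leaf (Finₚ.toℕ-injective (ℕₚ.∸-cancelʳ-≡ jx≥2 j≥2 (≡.sym same))))
      where
      same : toℕ j ∸ 2 ≡ toℕ jx ∸ 2
      same = trans (≡.sym e′) (trans e (Finₚ.toℕ-fromℕ< _))
      j≥2 : 2 ≤ toℕ j
      j≥2 with toℕ j ℕ.≤? 1
      ... | no j>1  = ℕₚ.≰⇒> j>1
      ... | yes j≤1 = ⊥-elim (ℕₚ.<⇒≢ (ℕₚ.m<n⇒0<n∸m (ℕₚ.≰⇒> jx>2)) (trans (≡.sym (ℕₚ.m≤n⇒m∸n≡0 (ℕₚ.≤-trans j≤1 (ℕₚ.n≤1+n 1)))) same))
    ... | inj₂ (_ , e′) = ⊥-elim (ℕₚ.<⇒≢ column< (≡.sym (trans (≡.sym e′) (trans e (Finₚ.toℕ-fromℕ< _)))))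

  critical-s+2 : Critical S G (5 + r)
  critical-s+2 = critical ℕₚ.≤-refl needs-s+2 leaf-deletion

-- The path on four vertices.
module Critical₃ (s : ℕ) (2≤s : 2 ≤ s) where
  open Coloring 1 2 0 2 s

  anchor-path : ∀ (j : Fin 2) → anchor j ≡ toℕ j
  anchor-path Fin.zero          = refl
  anchor-path (Fin.suc Fin.zero) = refl

  isCaterpillar : IsCaterpillar G
  isCaterpillar = SpineOfNonLeaves.isCaterpillar (s≤s z≤n) Fin.zero refl (Fin.suc Fin.zero) refl

  needs-3 : ∀ j → j < 3 → ¬ PackingColorable S G j
  needs-3 j j<3 (_ , c , coloring) with toℕ (c (spine Fin.zero)) ℕ.≟ 0
  ... | yes first = ℕₚ.<⇒≱ j<3 (window-clique {0} {0} {1} {1} 1 cand 2≤s)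
    where
    open NonFirst coloring
    cand : ∀ (a : Fin 2) → Candidate 0 0 1 1 (toℕ a)
    cand Fin.zero           = candidate-leaf 0 (s≤s z≤n) 0 refl refl
                                (SeqSPacking.color₁-neighbor coloring refl first) ℕₚ.≤-refl ℕₚ.≤-refl
    cand (Fin.suc Fin.zero) = candidate-spine 1 ℕₚ.≤-refl refl
                                (SeqSPacking.color₁-neighbor coloring refl first) z≤n ℕₚ.≤-refl
  ... | no nonfirst = ℕₚ.<⇒≱ j<3 (window-clique {0} {0} {2} {0} 1 cand 2≤s)
    where
    open NonFirst coloring
    cand : ∀ (a : Fin 2) → Candidate 0 0 2 0 (toℕ a)
    cand Fin.zero           = candidate-spine 0 (s≤s z≤n) refl (ℕₚ.n≢0⇒n>0 nonfirst) z≤n z≤n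
    cand (Fin.suc Fin.zero) = candidate-pick 1 ℕₚ.≤-refl ℕₚ.≤-refl refl ℕₚ.≤-refl ℕₚ.≤-refl

  leaf-deletion : ∀ j → PackingColorable S (delete G (leaf j)) 2
  leaf-deletion j = squeezed-colorable j (leaf j) (λ j′ e → inj₁ (cong leaf (Finₚ.toℕ-injective (trans (≡.sym e) (anchor-path j′))))) (ℕₚ.n≤1+n _)

  critical-3 : Critical S G 3
  critical-3 = critical ℕₚ.≤-refl needs-3 leaf-deletion

-- The case s = 2, k = 4: spine 0, 1, 2 with two leaves on each end vertex and one leaf on the middle one.
module Critical₄ where
  open Coloring 2 5 1 3 2

  pattern f0 = Fin.zero
  pattern f1 = Fin.suc Fin.zero
  pattern f2 = Fin.suc (Fin.suc Fin.zero)
  pattern f3 = Fin.suc (Fin.suc (Fin.suc Fin.zero))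
  pattern f4 = Fin.suc (Fin.suc (Fin.suc (Fin.suc Fin.zero)))

  isCaterpillar : IsCaterpillar G
  isCaterpillar = SpineOfNonLeaves.isCaterpillar (s≤s z≤n) Fin.zero refl f4 refl

  needs-4 : ∀ j → j < 4 → ¬ PackingColorable S G j
  needs-4 j j<4 (_ , c , coloring) with toℕ (c (spine f0)) ℕ.≟ 0 | toℕ (c (spine f2)) ℕ.≟ 0
  ... | yes first₀ | _ = ℕₚ.<⇒≱ j<4 (window-clique {0} {0} {1} {1} 2 cand ℕₚ.≤-refl)
    where
    open NonFirst coloring
    cand : ∀ (a : Fin 3) → Candidate 0 0 1 1 (toℕ a)
    cand f0 = candidate-leaf 0 (s≤s z≤n) 0 refl refl (SeqSPacking.color₁-neighbor coloring refl first₀) ℕₚ.≤-refl ℕₚ.≤-refl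
    cand f1 = candidate-leaf 1 (s≤s (s≤s z≤n)) 0 refl refl (SeqSPacking.color₁-neighbor coloring refl first₀) ℕₚ.≤-refl ℕₚ.≤-refl
    cand f2 = candidate-spine 1 (s≤s (s≤s z≤n)) refl (SeqSPacking.color₁-neighbor coloring refl first₀) z≤n ℕₚ.≤-refl
  ... | no _ | yes first₂ = ℕₚ.<⇒≱ j<4 (window-clique {2} {2} {3} {1} 2 cand ℕₚ.≤-refl)
    where
    open NonFirst coloring
    cand : ∀ (a : Fin 3) → Candidate 2 2 3 1 (toℕ a)
    cand f0 = candidate-spine 1 (s≤s (s≤s z≤n)) refl (SeqSPacking.color₁-neighbor coloring refl first₂) ℕₚ.≤-refl (s≤s z≤n)
    cand f1 = candidate-leaf 3 (s≤s (s≤s (s≤s (s≤s z≤n)))) 2 refl refl (SeqSPacking.color₁-neighbor coloring refl first₂) ℕₚ.≤-refl ℕₚ.≤-refl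
    cand f2 = candidate-leaf 4 ℕₚ.≤-refl 2 refl refl (SeqSPacking.color₁-neighbor coloring refl first₂) ℕₚ.≤-refl ℕₚ.≤-refl
  ... | no nonfirst₀ | no nonfirst₂ = ℕₚ.<⇒≱ j<4 (window-clique {1} {0} {2} {0} 2 cand ℕₚ.≤-refl)
    where
    open NonFirst coloring
    cand : ∀ (a : Fin 3) → Candidate 1 0 2 0 (toℕ a)
    cand f0 = candidate-spine 0 (s≤s z≤n) refl (ℕₚ.n≢0⇒n>0 nonfirst₀) z≤n z≤n
    cand f1 = candidate-pick 1 (s≤s (s≤s z≤n)) (s≤s (s≤s (s≤s z≤n))) refl ℕₚ.≤-refl ℕₚ.≤-refl
    cand f2 = candidate-spine 2 ℕₚ.≤-refl refl (ℕₚ.n≢0⇒n>0 nonfirst₂) z≤n ℕₚ.≤-refl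

  two-left-leaves : ∀ (jd : Fin 5) → toℕ jd ≤ 1 → leaf f0 ≢ leaf jd → leaf f1 ≢ leaf jd → ⊥
  two-left-leaves f0 _ p _ = p refl
  two-left-leaves f1 _ _ q = q refl
  two-left-leaves (Fin.suc (Fin.suc _)) (s≤s ()) _ _

  two-right-leaves : ∀ (jd : Fin 5) → 3 ≤ toℕ jd → leaf f3 ≢ leaf jd → leaf f4 ≢ leaf jd → ⊥
  two-right-leaves f3 _ p _ = p refl
  two-right-leaves f4 _ _ q = q refl
  two-right-leaves f0 () _ _
  two-right-leaves f1 (s≤s ()) _ _
  two-right-leaves f2 (s≤s (s≤s ())) _ _

  module LeftLeafDeletion (jd : Fin 5) (jd-side : toℕ jd ≤ 1) where
    x = leaf jd
    gL : ℕ → ℕ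
    gL 0 = 2
    gL 1 = 2
    gL _ = 0
    cn : V → ℕ
    cn = byKind (λ i → toℕ i) (λ j → gL (toℕ j))
    bounded′ : ∀ {v} → View v → cn v < 3
    bounded′ (spineᵛ f0) = s≤s z≤n
    bounded′ (spineᵛ f1) = s≤s (s≤s z≤n)
    bounded′ (spineᵛ f2) = ℕₚ.≤-refl
    bounded′ (leafᵛ f0) = ℕₚ.≤-refl
    bounded′ (leafᵛ f1) = ℕₚ.≤-refl
    bounded′ (leafᵛ f2) = s≤s z≤n
    bounded′ (leafᵛ f3) = s≤s z≤n
    bounded′ (leafᵛ f4) = s≤s z≤n
    bounded : ∀ v → cn v < 3
    bounded v = bounded′ (view v)
    A : ℕ → Set
    A p = p ≡ 0
    A-apart : ∀ p q → A p → A q → q ≢ suc p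
    A-apart p q refl refl ()
    Paired : Fin 5 → Set
    Paired j = toℕ j ≤ 1
    rank : Fin 5 → ℕ
    rank _ = 0
    rank-injective : ∀ j j' → Paired j → Paired j' → leaf j ≢ x → leaf j' ≢ x → rank j ≡ rank j' → j ≡ j'
    rank-injective f0 f0 _ _ _ _ _ = refl
    rank-injective f1 f1 _ _ _ _ _ = refl
    rank-injective f0 f1 _ _ p p' _ = ⊥-elim (two-left-leaves jd jd-side p p')
    rank-injective f1 f0 _ _ p p' _ = ⊥-elim (two-left-leaves jd jd-side p' p)
    rank-injective (Fin.suc (Fin.suc _)) _ (s≤s ()) _ _ _ _
    rank-injective _ (Fin.suc (Fin.suc _)) _ (s≤s ()) _ _ _
    Y-far : ∀ i j → toℕ i ≡ 2 → Paired j → DistGt G (spine i) (leaf j) 2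
    Y-far f2 f0 _ _ = far⇒DistGt′ (spine f2) (leaf f0) (spine≢leaf f2 f0) ℕₚ.≤-refl
    Y-far f2 f1 _ _ = far⇒DistGt′ (spine f2) (leaf f1) (spine≢leaf f2 f1) ℕₚ.≤-refl
    Y-far f2 (Fin.suc (Fin.suc _)) _ (s≤s ())
    Y-far f0 _ () _
    Y-far f1 _ () _
    Z-far : ∀ j → Paired j → DistGt G (leaf f3) (leaf j) 2
    Z-far f0 _ = far⇒DistGt′ (leaf f3) (leaf f0) (λ e → case0 (leaf-injective e)) (s≤s (s≤s (s≤s z≤n)))
      where
      case0 : f3 ≢ f0
      case0 ()
    Z-far f1 _ = far⇒DistGt′ (leaf f3) (leaf f1) (λ e → case1 (leaf-injective e)) (s≤s (s≤s (s≤s z≤n)))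
      where
      case1 : f3 ≢ f1
      case1 ()
    Z-far (Fin.suc (Fin.suc _)) (s≤s ())
    open ClassCertificate cn x A A-apart 0 1 2 3 ℕₚ.≤-refl ℕₚ.≤-refl 2 Paired rank f3 rank-injective Y-far Z-far
    classify′ : ∀ {v} → View v → v ≢ x → Class v
    classify′ (spineᵛ f0) _ = first refl (inj₁ (refl , refl))
    classify′ (spineᵛ f1) _ = shifted f1 refl refl (s≤s z≤n) ℕₚ.≤-refl
    classify′ (spineᵛ f2) _ = Y-spine f2 refl refl refl
    classify′ (leafᵛ f0) _ = Y-leaf f0 refl z≤n refl refl
    classify′ (leafᵛ f1) _ = Y-leaf f1 refl (s≤s z≤n) refl refl
    classify′ (leafᵛ f2) _ = first refl (inj₂ (refl , λ ()))
    classify′ (leafᵛ f3) _ = first refl (inj₂ (refl , λ ()))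
    classify′ (leafᵛ f4) _ = first refl (inj₂ (refl , λ ()))
    classify : ∀ v → v ≢ x → Class v
    classify v = classify′ (view v)

    colorable-without : PackingColorable S (delete G (leaf jd)) 3
    colorable-without = colorable-delete cn 3 x (ℕₚ.n≤1+n _) bounded (Certified.independent classify) (Certified.packed classify)

  module RightLeafDeletion (jd : Fin 5) (jd-side : 3 ≤ toℕ jd) where
    x = leaf jd
    gR : ℕ → ℕ
    gR 3 = 2
    gR 4 = 2
    gR _ = 0
    cn : V → ℕ
    cn = byKind (λ i → 2 ∸ toℕ i) (λ j → gR (toℕ j))
    bounded′ : ∀ {v} → View v → cn v < 3
    bounded′ (spineᵛ f0) = ℕₚ.≤-refl
    bounded′ (spineᵛ f1) = s≤s (s≤s z≤n)
    bounded′ (spineᵛ f2) = s≤s z≤n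
    bounded′ (leafᵛ f0) = s≤s z≤n
    bounded′ (leafᵛ f1) = s≤s z≤n
    bounded′ (leafᵛ f2) = s≤s z≤n
    bounded′ (leafᵛ f3) = ℕₚ.≤-refl
    bounded′ (leafᵛ f4) = ℕₚ.≤-refl
    bounded : ∀ v → cn v < 3
    bounded v = bounded′ (view v)
    A : ℕ → Set
    A p = p ≡ 2
    A-apart : ∀ p q → A p → A q → q ≢ suc p
    A-apart p q refl refl ()
    Paired : Fin 5 → Set
    Paired j = 3 ≤ toℕ j
    rank : Fin 5 → ℕ
    rank _ = 0
    rank-injective : ∀ j j' → Paired j → Paired j' → leaf j ≢ x → leaf j' ≢ x → rank j ≡ rank j' → j ≡ j'
    rank-injective f3 f3 _ _ _ _ _ = refl
    rank-injective f4 f4 _ _ _ _ _ = refl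
    rank-injective f3 f4 _ _ p p' _ = ⊥-elim (two-right-leaves jd jd-side p p')
    rank-injective f4 f3 _ _ p p' _ = ⊥-elim (two-right-leaves jd jd-side p' p)
    rank-injective f0 _ () _ _ _ _
    rank-injective f1 _ (s≤s ()) _ _ _ _
    rank-injective f2 _ (s≤s (s≤s ())) _ _ _ _
    rank-injective _ f0 _ () _ _ _
    rank-injective _ f1 _ (s≤s ()) _ _ _
    rank-injective _ f2 _ (s≤s (s≤s ())) _ _ _
    Y-far : ∀ i j → toℕ i ≡ 0 → Paired j → DistGt G (spine i) (leaf j) 2
    Y-far f0 f3 _ _ = far⇒DistGt (spine f0) (leaf f3) (spine≢leaf f0 f3) ℕₚ.≤-refl
    Y-far f0 f4 _ _ = far⇒DistGt (spine f0) (leaf f4) (spine≢leaf f0 f4) ℕₚ.≤-refl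
    Y-far f0 f0 _ ()
    Y-far f0 f1 _ (s≤s ())
    Y-far f0 f2 _ (s≤s (s≤s ()))
    Y-far f1 _ () _
    Y-far f2 _ () _
    Z-far : ∀ j → Paired j → DistGt G (leaf f0) (leaf j) 2
    Z-far f3 _ = far⇒DistGt (leaf f0) (leaf f3) (λ e → c3 (leaf-injective e)) (s≤s (s≤s (s≤s z≤n)))
      where
      c3 : f0 ≢ f3
      c3 ()
    Z-far f4 _ = far⇒DistGt (leaf f0) (leaf f4) (λ e → c4 (leaf-injective e)) (s≤s (s≤s (s≤s z≤n)))
      where
      c4 : f0 ≢ f4
      c4 ()
    Z-far f0 ()
    Z-far f1 (s≤s ())
    Z-far f2 (s≤s (s≤s ()))
    open ClassCertificate cn x A A-apart 0 1 2 3 ℕₚ.≤-refl ℕₚ.≤-refl 0 Paired rank f0 rank-injective Y-far Z-far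
    classify′ : ∀ {v} → View v → v ≢ x → Class v
    classify′ (spineᵛ f0) _ = Y-spine f0 refl refl refl
    classify′ (spineᵛ f1) _ = shifted f1 refl refl (s≤s z≤n) ℕₚ.≤-refl
    classify′ (spineᵛ f2) _ = first refl (inj₁ (refl , refl))
    classify′ (leafᵛ f0) _ = first refl (inj₂ (refl , λ ()))
    classify′ (leafᵛ f1) _ = first refl (inj₂ (refl , λ ()))
    classify′ (leafᵛ f2) _ = first refl (inj₂ (refl , λ ()))
    classify′ (leafᵛ f3) _ = Y-leaf f3 refl (s≤s (s≤s (s≤s z≤n))) refl refl
    classify′ (leafᵛ f4) _ = Y-leaf f4 refl (s≤s (s≤s (s≤s z≤n))) refl refl
    classify : ∀ v → v ≢ x → Class v
    classify v = classify′ (view v)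

    colorable-without : PackingColorable S (delete G (leaf jd)) 3
    colorable-without = colorable-delete cn 3 x (ℕₚ.n≤1+n _) bounded (Certified.independent classify) (Certified.packed classify)

  leaf-deletion : ∀ j → PackingColorable S (delete G (leaf j)) 3
  leaf-deletion f0 = LeftLeafDeletion.colorable-without f0 z≤n
  leaf-deletion f1 = LeftLeafDeletion.colorable-without f1 (s≤s z≤n)
  leaf-deletion f2 = squeezed-colorable f1 (leaf f2) only-f2 (ℕₚ.n≤1+n _)
    where
    only-f2 : ∀ j → anchor j ≡ 1 → leaf f2 ≡ leaf j ⊎ leaf f2 ≡ spine f1
    only-f2 f2 _ = inj₁ refl
  leaf-deletion f3 = RightLeafDeletion.colorable-without f3 ℕₚ.≤-refl
  leaf-deletion f4 = RightLeafDeletion.colorable-without f4 (s≤s (s≤s (s≤s z≤n)))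

  critical-4 : Critical S G 4
  critical-4 = critical ℕₚ.≤-refl needs-4 leaf-deletion

CriticalCaterpillar : ℕ → ℕ → Set
CriticalCaterpillar k s = ∃ λ n → ∃ λ (G : Graph (suc n)) → IsCaterpillar G × Critical (seqS k s) G k

module Critical₁ (s : ℕ) where
  K₁ : Graph 1
  K₁ = record { adj = λ _ _ → false ; sym = λ _ _ → refl ; irrefl = λ _ → refl }

  isCaterpillar : IsCaterpillar K₁
  isCaterpillar = (connected , acyclic) , Fin.zero ∷ [] , ∈⇔nonleaf , ([] ∷ []) , λ _ _ _ _ → mk⇔ (λ ()) λ { (inj₁ (later ())) ; (inj₂ (later ())) }
    where
    connected : Connected K₁
    connected Fin.zero Fin.zero = 0 , here
    acyclic : ¬ HasCycle K₁
    acyclic ([]                     , ()     , _)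
    acyclic (_ ∷ []                 , s≤s () , _)
    acyclic (Fin.zero ∷ Fin.zero ∷ _ , _     , ((0≢0 ∷ _) ∷ _) , _) = 0≢0 refl
    ∈⇔nonleaf : ∀ v → (v ∈ Fin.zero ∷ []) ⇔ (¬ IsLeaf K₁ v)
    ∈⇔nonleaf Fin.zero = mk⇔ (λ _ ()) (λ _ → Any.here refl)

  critical-1 : Critical (seqS 1 s) K₁ 1
  critical-1 = (one-color , λ { 0 (s≤s z≤n) (_ , _ , bounded , _) → ℕₚ.n≮0 (bounded Fin.zero) }) ,
               λ _ → 0 , s≤s z≤n , (z≤n , (λ ()) , (λ ()) , λ ()) , λ _ ()
    where
    one-color : PackingColorable (seqS 1 s) K₁ 1
    one-color = s≤s z≤n , (λ _ → Fin.zero) , (λ _ → s≤s z≤n) , λ { Fin.zero Fin.zero 0≢0 _ → ⊥-elim (0≢0 refl) }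

module Critical₂ (s : ℕ) where
  open Coloring 0 1 0 1 s

  isCaterpillar : IsCaterpillar G
  isCaterpillar = (connected , acyclic) , [] , (λ v → mk⇔ (λ ()) (λ nonleaf → ⊥-elim (nonleaf (isLeaf (view v))))) , [] , λ _ _ ()
    where
    isLeaf : ∀ {v} → View v → IsLeaf G v
    isLeaf (spineᵛ Fin.zero) = refl
    isLeaf (leafᵛ j)         = leaf-isLeaf j

  needs-2 : ∀ j → j < 2 → ¬ PackingColorable S G j
  needs-2 j (s≤s j≤1) (_ , c , coloring) with toℕ (c (spine Fin.zero)) ℕ.≟ 0
  ... | yes first   = ℕₚ.<⇒≱ (ℕₚ.≤-trans (proj₁ coloring (leaf Fin.zero)) j≤1)
                             (SeqSPacking.color₁-neighbor coloring refl first)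
  ... | no nonfirst = ℕₚ.<⇒≱ (ℕₚ.≤-trans (proj₁ coloring (spine Fin.zero)) j≤1) (ℕₚ.n≢0⇒n>0 nonfirst)

  leaf-deletion : ∀ j → PackingColorable S (delete G (leaf j)) 1
  leaf-deletion Fin.zero = colorable-delete (λ _ → 0) 1 (leaf Fin.zero) (s≤s z≤n) (λ _ → s≤s z≤n) single (λ _ _ _ _ _ _ ())
    where
    single : FirstClassIndependent (λ _ → 0) (_≢ leaf Fin.zero)
    single Fin.zero Fin.zero _ _ 0≢0 _ _ = ⊥-elim (0≢0 refl)
    single Fin.zero (Fin.suc Fin.zero) _ 1≢1 _ _ _ = ⊥-elim (1≢1 refl)
    single (Fin.suc Fin.zero) _ 1≢1 _ _ _ _ = ⊥-elim (1≢1 refl)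

  critical-2 : Critical S G 2
  critical-2 = critical ℕₚ.≤-refl needs-2 leaf-deletion

critical-caterpillar : ∀ k s → 1 ≤ k → 2 ≤ s → k ≤ s + 2 → CriticalCaterpillar k s
critical-caterpillar 1 s _ _ _ = 0 , Critical₁.K₁ s , Critical₁.isCaterpillar s , Critical₁.critical-1 s
critical-caterpillar 2 s _ _ _ = _ , Coloring.G 0 1 0 1 s , Critical₂.isCaterpillar s , Critical₂.critical-2 s
critical-caterpillar 3 s _ 2≤s _ = _ , _ , Critical₃.isCaterpillar s 2≤s , Critical₃.critical-3 s 2≤s
critical-caterpillar k@(suc (suc (suc (suc t)))) s _ 2≤s k≤s+2 with k ℕ.≤? s | ℕₚ.m≤n⇒m<n∨m≡n (subst (k ≤_) (ℕₚ.+-comm s 2) k≤s+2)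
... | yes k≤s | _ = _ , _ , CriticalComb.isCaterpillar (2 + t) s (s≤s z≤n) k≤s , CriticalComb.critical-comb (2 + t) s (s≤s z≤n) k≤s
... | no k>s | inj₁ k<s+2 rewrite ℕₚ.≤-antisym (ℕₚ.≤-pred (ℕₚ.≰⇒> k>s)) (ℕₚ.≤-pred (ℕₚ.≤-pred k<s+2)) =
  _ , _ , CriticalS+1.isCaterpillar t , CriticalS+1.critical-s+1 t
... | no _ | inj₂ k≡s+2 with s | k≡s+2
...   | suc (suc zero)    | refl = _ , _ , Critical₄.isCaterpillar , Critical₄.critical-4
...   | suc (suc (suc r)) | refl = _ , _ , CriticalS+2.isCaterpillar r , CriticalS+2.critical-s+2 r

critical⇒k≤s+2 : ∀ {k s} → 1 ≤ k → CriticalCaterpillar k s → k ≤ s + 2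
critical⇒k≤s+2 {suc k} {s} _ (_ , G , cat , (_ , fewer-fail) , _) with suc k ℕ.≤? s + 2
... | yes k≤s+2 = k≤s+2
... | no k>s+2  = ⊥-elim (fewer-fail (suc (suc s)) (s≤s s+2≤k) (caterpillar-colorable (suc k) s G cat (ℕₚ.≤-trans s+2≤k (ℕₚ.n≤1+n k))))
  where
  s+2≤k : suc (suc s) ≤ k
  s+2≤k = subst (_≤ k) (ℕₚ.+-comm s 2) (ℕₚ.≤-pred (ℕₚ.≰⇒> k>s+2))

mainTheorem8 : ∀ (k s₂ : ℕ) → 1 ≤ k → 2 ≤ s₂ →
    (∃ λ n → ∃ λ (G : Graph (suc n)) → IsCaterpillar G × Critical (seqS k s₂) G k)
    ⇔ (k ≤ s₂ + 2)
mainTheorem8 k s₂ 1≤k 2≤s₂ = mk⇔ (critical⇒k≤s+2 1≤k) (critical-caterpillar k s₂ 1≤k 2≤s₂)
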